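{- Let $G$ be a finite graph and $\mathcal L$ a non-trivial linear class of bonds of $G$. Then the independent sets of the complete join matroid $J_0(G,\mathcal L)$ are exactly: (1) the edge sets of forests of $G$, and (2) the sets $F\cup\{e_0\}$ where $F$ is the edge set of a forest of $G$ and the partition $\pi_F$ is un-cobalanced.
   Context: Graphs are finite, loops and multiple edges allowed. A bond is a minimal nonempty edge cut; $\delta(X)$ is the set of links with exactly one endpoint in $X\subseteq V(G)$. A tribond is $\delta(X_1)\cup\delta(X_2)\cup\delta(X_3)$ for a partition $\{X_1,X_2,X_3\}$ of the vertex set of one connected component into nonempty sets with each $G[X_i]$ connected and an edge joining each pair. A linear class of bonds is a set $\mathcal L$ of bonds such that for each such tripartition the number of $i$ with $\delta(X_i)\in\mathcal L$ is never exactly two; it is trivial if it contains every bond; bonds in $\mathcal L$ are cobalanced. A modular pair of bonds $B_1,B_2$ is one for which $G-(B_1\cup B_2)$ has two more components than $G$; a dibond is the union of a modular pair that is not a tribond. For non-trivial $\mathcal L$, $J_0(G,\mathcal L)$ is the matroid on $E(G)\cup\{e_0\}$ whose cocircuits are the bonds in $\mathcal L$, the sets $B\cup\{e_0\}$ for bonds $B\notin\mathcal L$, and the tribonds and dibonds containing no bond of $\mathcal L$. For $F\subseteq E(G)$, $\pi_F$ is the partition of $V(G)$ into vertex sets of the components of $(V(G),F)$; $\mathrm{Ext}(\pi)$ is the set of edges of $G$ whose endpoints lie in different parts of $\pi$. A partition $\pi$ (with each part inducing a connected subgraph) is cobalanced if every bond of $G$ contained in $\mathrm{Ext}(\pi)$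 lies in $\mathcal L$, and un-cobalanced otherwise. -}

module Defs where

open import Data.Nat using (ℕ; zero; suc; _+_; _%_)
open import Data.Nat.DivMod using (m%n<n)
open import Data.Bool using (Bool; true; false; _xor_; _∧_)
open import Data.Fin using (Fin; zero; suc; toℕ; fromℕ<)
open import Data.Fin.Subset using (Subset; _∈_; _∉_; _⊆_; _∪_; _∩_; ∁; ⁅_⁆; Nonempty; outside; inside)
open import Data.Vec using (Vec; _∷_; lookup; tabulate)
open import Data.Product using (Σ; _×_; _,_; proj₁; proj₂; ∃; ∃-syntax)
open import Data.Sum using (_⊎_)
open import Data.Empty using (⊥)
open import Relation.Nullary using (¬_)
open import Relation.Binary.PropositionalEquality using (_≡_; _≢_)
open import Function.Definitions using (Injective)

-- Finite graphs with loops and multiple edges allowed: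
-- vertex set Fin n, edge set Fin m, each edge has two (possibly equal)
-- endpoints.

record Graph : Set where
  field
    n    : ℕ
    m    : ℕ
    ends : Fin m → Fin n × Fin n

module _ (G : Graph) where
  open Graph G

  end₁ end₂ : Fin m → Fin n
  end₁ e = proj₁ (ends e)
  end₂ e = proj₂ (ends e)

  Joins : Fin m → Fin n → Fin n → Set
  Joins e u v = (end₁ e ≡ u × end₂ e ≡ v) ⊎ (end₁ e ≡ v × end₂ e ≡ u)

  data Reach (F : Subset m) : Fin n → Fin n → Set where
    here : ∀ {u} → Reach F u u
    step : ∀ {u v w} (e : Fin m) → e ∈ F → Joins e u v → Reach F v w → Reach F u w

  allEdges : Subset m
  allEdges = tabulate (λ _ → true)

  inducedEdges : Subset n → Subset m
  inducedEdges X = tabulate (λ e → lookup X (end₁ e) ∧ lookup X (end₂ e))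

  InducesConnected : Subset n → Set
  InducesConnected X = Nonempty X × (∀ u v → u ∈ X → v ∈ X → Reach (inducedEdges X) u v)

  δ : Subset n → Subset m
  δ X = tabulate (λ e → lookup X (end₁ e) xor lookup X (end₂ e))

  IsCut : Subset m → Set
  IsCut B = ∃[ X ] B ≡ δ X

  IsBond : Subset m → Set
  IsBond B = IsCut B × Nonempty B ×
             (∀ C → IsCut C → Nonempty C → C ⊆ B → C ≡ B)

  IsComponent : Subset n → Set
  IsComponent K = Nonempty K × (∀ u v → u ∈ K → (v ∈ K → Reach allEdges u v) × (Reach allEdges u v → v ∈ K))

  EdgeBetween : Subset n → Subset n → Set
  EdgeBetween X Y = ∃[ e ] ∃[ u ] ∃[ v ] (u ∈ X × v ∈ Y × Joins e u v)

  Disjoint : ∀ {k} → Subset k → Subset k → Set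
  Disjoint {k} X Y = ∀ (x : Fin k) → x ∈ X → x ∉ Y

  IsTripartition : Subset n → Subset n → Subset n → Set
  IsTripartition X₁ X₂ X₃ =
    IsComponent (X₁ ∪ X₂ ∪ X₃) ×
    Disjoint X₁ X₂ × Disjoint X₁ X₃ × Disjoint X₂ X₃ ×
    InducesConnected X₁ × InducesConnected X₂ × InducesConnected X₃ ×
    EdgeBetween X₁ X₂ × EdgeBetween X₁ X₃ × EdgeBetween X₂ X₃

  IsTribond : Subset m → Set
  IsTribond T = ∃[ X₁ ] ∃[ X₂ ] ∃[ X₃ ]
    (IsTripartition X₁ X₂ X₃ × T ≡ δ X₁ ∪ δ X₂ ∪ δ X₃)

  -- A class of bonds is represented by its (decidable) membership
  -- predicate  L : Subset m → Bool  (B ∈ 𝓛  iff  L B ≡ true).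
  bit : Bool → ℕ
  bit true  = 1
  bit false = 0

  IsLinearClass : (Subset m → Bool) → Set
  IsLinearClass L =
    (∀ B → L B ≡ true → IsBond B) ×
    (∀ X₁ X₂ X₃ → IsTripartition X₁ X₂ X₃ →
       bit (L (δ X₁)) + bit (L (δ X₂)) + bit (L (δ X₃)) ≢ 2)

  NonTrivial : (Subset m → Bool) → Set
  NonTrivial L = ∃[ B ] (IsBond B × L B ≡ false)

  HasComponents : Subset m → ℕ → Set
  HasComponents F k = Σ (Fin k → Fin n) λ r → (Injective _≡_ _≡_ r ×
       (∀ i j → Reach F (r i) (r j) → i ≡ j) ×
       (∀ v → ∃[ i ] Reach F (r i) v))

  IsModularPair : Subset m → Subset m → Set
  IsModularPair B₁ B₂ = IsBond B₁ × IsBond B₂ ×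
    ∃[ k ] (HasComponents allEdges k × HasComponents (∁ (B₁ ∪ B₂)) (2 + k))

  IsDibond : Subset m → Set
  IsDibond D = ∃[ B₁ ] ∃[ B₂ ] (IsModularPair B₁ B₂ × D ≡ B₁ ∪ B₂) × ¬ IsTribond D

  -- The complete join matroid J₀(G,𝓛) on E(G) ∪ {e₀}.
  -- Ground set: Fin (suc m), where zero is e₀ and suc e is the edge e.
  -- A subset of the ground set is  b ∷ F  with b the e₀-bit, F ⊆ E(G).

  ContainsNoBondOf : (Subset m → Bool) → Subset m → Set
  ContainsNoBondOf L T = ∀ B → IsBond B → L B ≡ true → ¬ (B ⊆ T)

  J₀Cocircuit : (Subset m → Bool) → Subset (suc m) → Set
  J₀Cocircuit L D =
    (∃[ B ] (IsBond B × L B ≡ true  × D ≡ outside ∷ B)) ⊎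
    (∃[ B ] (IsBond B × L B ≡ false × D ≡ inside ∷ B)) ⊎
    (∃[ T ] ((IsTribond T ⊎ IsDibond T) × ContainsNoBondOf L T × D ≡ outside ∷ T))

  -- Independent sets of the matroid with the given cocircuits:
  -- I is independent iff its complement is spanning in the dual matroid,
  -- i.e. E ∖ I contains a basis of the dual (a maximal set containing
  -- no cocircuit).
  CocircuitFree : (Subset m → Bool) → Subset (suc m) → Set
  CocircuitFree L S = ∀ D → J₀Cocircuit L D → ¬ (D ⊆ S)

  J₀Independent : (Subset m → Bool) → Subset (suc m) → Set
  J₀Independent L I = ∃[ B ] (Disjoint B I × CocircuitFree L B ×
     (∀ x → x ∉ B → ∃[ D ] (J₀Cocircuit L D × D ⊆ (⁅ x ⁆ ∪ B))))

  -- A cycle of length suc k: distinct vertices v₀..v_k, distinct edges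
  -- e₀..e_k in F, with e_i joining v_i and v_{i+1 mod (suc k)}
  -- (k = 0: a loop; k = 1: two parallel edges).
  nextMod : ∀ {k} → Fin (suc k) → Fin (suc k)
  nextMod {k} i = fromℕ< (m%n<n (suc (toℕ i)) (suc k))

  HasCycle : Subset m → Set
  HasCycle F = ∃[ k ] Σ (Fin (suc k) → Fin n) λ vs → Σ (Fin (suc k) → Fin m) λ es →
    (Injective _≡_ _≡_ vs ×
     Injective _≡_ _≡_ es ×
     (∀ i → es i ∈ F) ×
     (∀ i → Joins (es i) (vs i) (vs (nextMod i))))

  IsForest : Subset m → Set
  IsForest F = ¬ HasCycle F

  -- Ext(π_F): e ∈ Ext(π_F) iff the endpoints of e lie in different
  -- components of (V(G), F)
  InExt : Subset m → Fin m → Set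
  InExt F e = ¬ Reach F (end₁ e) (end₂ e)

  UnCobalanced : (Subset m → Bool) → Subset m → Set
  UnCobalanced L F = ∃[ B ] (IsBond B × (∀ e → e ∈ B → InExt F e) × L B ≡ false)

-- Independence in J₀ is witnessed by a complementary dual basis. If I is independent, the first
-- edge of a cycle of F lies in a cocircuit inside the dual basis plus that edge, and this cocircuit
-- contains a cut crossed by the cycle exactly once; and if e₀ ∈ I, the cocircuit through e₀ is
-- B₀ ∪ {e₀} with B₀ an un-cobalanced bond disjoint from F, hence inside Ext(π_F).
-- Conversely, extend the forest F to a maximal forest T of G, or of G − B₀ when B₀ is an
-- un-cobalanced bond in Ext(π_F); the complement of T is a dual basis (with e₀ in the first case).
-- It contains no cocircuit because T meets every nonempty cut other than B₀, and B₀ is neither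
-- cobalanced, nor two sides of a tribond, nor modular with itself. Each edge t of T lies in a
-- cocircuit inside the complement plus t: a fundamental cut of t, or, in the second case, a
-- dibond formed with B₀ or a tribond made of the two sides of t and the class beyond B₀. These
-- contain no bond of 𝓛 because every cut inside them is determined by its sides on a few anchor
-- vertices.

module Submission where

open import Defs
open import Data.Bool using (Bool; true; false; _xor_; _∧_; not)
open import Data.Bool.Properties using (xor-comm; true-xor; not-involutive; ∧-conicalˡ; ∧-conicalʳ; ∧-identityʳ; ∧-zeroʳ) renaming (_≟_ to _≟ᵇ_)
open import Data.Nat using (ℕ; zero; suc; _+_; _%_; _<_; s≤s; z≤n)
open import Data.Nat.Properties using (+-suc; +-identityʳ; m<m+n; ≤-antisym)
open import Data.Unit using (⊤; tt)
open import Data.Fin using (Fin; zero; suc; _≟_; toℕ; fromℕ; inject₁)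
open import Data.Fin.Properties using (toℕ-fromℕ<; toℕ-injective; toℕ-fromℕ; toℕ-inject₁; toℕ<n; suc-injective; injective⇒≤; any?)
open import Data.Fin.Subset using (Subset; outside; inside; _∈_; _∉_; _⊆_; _∪_; _∩_; ∁; ⁅_⁆; Nonempty)
import Data.Fin.Subset as Subset
open import Data.Fin.Subset.Properties using (_∈?_; drop-there; x∈⁅x⁆; x∈⁅y⁆⇒x≡y; ⊆-antisym; x∈p∩q⁺; x∈p∩q⁻; x∈p∪q⁺; x∈p∪q⁻; ∉⊥; x∈∁p⇒x∉p; x∉p⇒x∈∁p; x∉∁p⇒x∈p)
open import Data.Vec using (_∷_; lookup; tabulate; here; there)
open import Data.Vec.Properties using (tabulate-cong; lookup∘tabulate; []=⇒lookup; lookup⇒[]=; lookup-map)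
open import Data.List using (List; []; _∷_; allFin)
import Data.List as List
import Data.List.Relation.Unary.Any as Any
open import Data.List.Membership.Propositional using () renaming (_∈_ to _∈ₗ_)
open import Data.List.Membership.Propositional.Properties using (∈-allFin)
open import Data.Nat.DivMod using (m<n⇒m%n≡m; n%n≡0)
open import Function.Definitions using (Injective)
open import Function.Bundles using (_⇔_; mk⇔)
open import Data.Product using (Σ; _×_; _,_; proj₁; proj₂; ∃-syntax)
open import Data.Sum using (_⊎_; inj₁; inj₂; [_,_]′)
import Data.Sum as Sum
open import Data.Empty using (⊥; ⊥-elim)
open import Relation.Nullary using (¬_; Dec; yes; no; does)
open import Relation.Nullary.Decidable using (_×-dec_; _⊎-dec_; map′; dec-true; dec-false; decidable-stable)
open import Relation.Binary.PropositionalEquality using (_≡_; _≢_; refl; sym; trans; cong; subst; subst₂; cong₂)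

module _ {k : ℕ} {p : Subset k} {x : Fin k} where

  ∈⇒lookup≡true : x ∈ p → lookup p x ≡ true
  ∈⇒lookup≡true = []=⇒lookup

  lookup≡true⇒∈ : lookup p x ≡ true → x ∈ p
  lookup≡true⇒∈ = lookup⇒[]= x p

  ∉⇒lookup≡false : x ∉ p → lookup p x ≡ false
  ∉⇒lookup≡false x∉p with lookup p x in eq
  ... | true  = ⊥-elim (x∉p (lookup≡true⇒∈ eq))
  ... | false = refl

  lookup≡false⇒∉ : lookup p x ≡ false → x ∉ p
  lookup≡false⇒∉ eq x∈p with trans (sym (∈⇒lookup≡true x∈p)) eq
  ... | ()

true≢false : true ≢ false
true≢false ()

xor≡false⇒≡ : ∀ {a b} → a xor b ≡ false → a ≡ b
xor≡false⇒≡ {true} {true} _ = refl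
xor≡false⇒≡ {false} {false} _ = refl

xor≡true⇒≢ : ∀ {a b} → a xor b ≡ true → a ≢ b
xor≡true⇒≢ {true} {false} _ ()
xor≡true⇒≢ {false} {true} _ ()

≢⇒xor≡true : ∀ {a b} → a ≢ b → a xor b ≡ true
≢⇒xor≡true {true} {true} ne = ⊥-elim (ne refl)
≢⇒xor≡true {true} {false} _ = refl
≢⇒xor≡true {false} {true} _ = refl
≢⇒xor≡true {false} {false} ne = ⊥-elim (ne refl)

≡⇒xor≡false : ∀ {a b} → a ≡ b → a xor b ≡ false
≡⇒xor≡false {true} refl = refl
≡⇒xor≡false {false} refl = refl

xor-swap : ∀ a₁ a₂ b₁ b₂ → a₁ xor a₂ ≡ b₁ xor b₂ → a₁ xor b₁ ≡ a₂ xor b₂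
xor-swap true  true  true  true  _ = refl
xor-swap true  true  false false _ = refl
xor-swap true  false true  false _ = refl
xor-swap true  false false true  _ = refl
xor-swap false true  true  false _ = refl
xor-swap false true  false true  _ = refl
xor-swap false false true  true  _ = refl
xor-swap false false false false _ = refl
xor-swap true  true  true  false ()
xor-swap true  true  false true  ()
xor-swap true  false true  true  ()
xor-swap true  false false false ()
xor-swap false true  true  true  ()
xor-swap false true  false false ()
xor-swap false false true  false ()
xor-swap false false false true  ()

xor-cancel : ∀ z x {y} → z xor x ≡ true xor y → x ≡ y → z ≡ true
xor-cancel true  x _ _ = refl
xor-cancel false true  {true}  () refl
xor-cancel false false {false} () refl

not-xor-not : ∀ a b → not a xor not b ≡ a xor b
not-xor-not true b = refl
not-xor-not false b = not-involutive b

xor-triangle : ∀ x y z → (x xor y) xor (x xor z) ≡ y xor z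
xor-triangle true  y z = trans (cong₂ _xor_ (true-xor y) (true-xor z)) (not-xor-not y z)
xor-triangle false y z = refl

bool-either : ∀ {x y z : Bool} → x ≢ y → z ≡ x ⊎ z ≡ y
bool-either {true} {true} x≢y = ⊥-elim (x≢y refl)
bool-either {true} {false} {true} _ = inj₁ refl
bool-either {true} {false} {false} _ = inj₂ refl
bool-either {false} {true} {true} _ = inj₂ refl
bool-either {false} {true} {false} _ = inj₁ refl
bool-either {false} {false} x≢y = ⊥-elim (x≢y refl)

bool-third : ∀ {x y z : Bool} → x ≢ z → z ≢ y → x ≡ y
bool-third {true} {true} _ _ = refl
bool-third {false} {false} _ _ = refl
bool-third {true} {false} {true} x≢z _ = ⊥-elim (x≢z refl)
bool-third {true} {false} {false} _ z≢y = ⊥-elim (z≢y refl)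
bool-third {false} {true} {true} _ z≢y = ⊥-elim (z≢y refl)
bool-third {false} {true} {false} x≢z _ = ⊥-elim (x≢z refl)

pair : ∀ {A : Set} → A → A → Fin 2 → A
pair x y zero = x
pair x y (suc zero) = y

triple : ∀ {A : Set} → A → A → A → Fin 3 → A
triple x y z zero = x
triple x y z (suc zero) = y
triple x y z (suc (suc zero)) = z

∈⁅x⁆∪⇒∈ : ∀ {k} {x y : Fin k} {B} → y ∈ ⁅ x ⁆ ∪ B → y ≢ x → y ∈ B
∈⁅x⁆∪⇒∈ {B = B} y∈ y≢x with x∈p∪q⁻ ⁅ _ ⁆ B y∈
... | inj₁ y∈⁅x⁆ = ⊥-elim (y≢x (x∈⁅y⁆⇒x≡y _ y∈⁅x⁆))
... | inj₂ y∈B = y∈B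

⊆-edge∪∁ : ∀ {k c c′} (t : Fin k) C T → (c ≡ inside → c′ ≡ inside) → (∀ e → e ∈ C → e ∈ T → e ≡ t) →
           (c ∷ C) ⊆ ⁅ suc t ⁆ ∪ (c′ ∷ ∁ T)
⊆-edge∪∁ t C T c⇒c′ C∩T⊆t here with c⇒c′ refl
... | refl = x∈p∪q⁺ {p = ⁅ suc t ⁆} (inj₂ here)
⊆-edge∪∁ t C T c⇒c′ C∩T⊆t (there {i = e} e∈C) with e ∈? T
... | yes e∈T = x∈p∪q⁺ (inj₁ (subst (λ z → suc z ∈ ⁅ suc t ⁆) (sym (C∩T⊆t e e∈C e∈T)) (x∈⁅x⁆ (suc t))))
... | no e∉T = x∈p∪q⁺ {p = ⁅ suc t ⁆} (inj₂ (there (x∉p⇒x∈∁p e∉T)))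

module _ (G : Graph) where
  open Graph G

  src tgt : Fin m → Fin n
  src = end₁ G
  tgt = end₂ G

  infix 4 _~[_]_
  _~[_]_ : Fin n → Subset m → Fin n → Set
  u ~[ S ] v = Reach G S u v

  joins-sym : ∀ {e u v} → Joins G e u v → Joins G e v u
  joins-sym (inj₁ x) = inj₂ x
  joins-sym (inj₂ x) = inj₁ x

  joins-ends : ∀ e → Joins G e (src e) (tgt e)
  joins-ends e = inj₁ (refl , refl)

  joins-common-end : ∀ {e u v x y} → Joins G e u v → Joins G e x y → u ≡ x ⊎ u ≡ y
  joins-common-end (inj₁ (p , _)) (inj₁ (q , _)) = inj₁ (trans (sym p) q)
  joins-common-end (inj₁ (p , _)) (inj₂ (q , _)) = inj₂ (trans (sym p) q)
  joins-common-end (inj₂ (_ , p)) (inj₁ (_ , q)) = inj₂ (trans (sym p) q)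
  joins-common-end (inj₂ (_ , p)) (inj₂ (_ , q)) = inj₁ (trans (sym p) q)

  ∈allEdges : ∀ e → e ∈ allEdges G
  ∈allEdges e = lookup≡true⇒∈ (lookup∘tabulate _ e)

  ⊆allEdges : ∀ {S} → S ⊆ allEdges G
  ⊆allEdges {x = e} _ = ∈allEdges e

  reach-trans : ∀ {S u v w} → u ~[ S ] v → v ~[ S ] w → u ~[ S ] w
  reach-trans here q = q
  reach-trans (step e h j p) q = step e h j (reach-trans p q)

  reach-edge : ∀ {S e u v} → e ∈ S → Joins G e u v → u ~[ S ] v
  reach-edge {e = e} h j = step e h j here

  reach-sym : ∀ {S u v} → u ~[ S ] v → v ~[ S ] u
  reach-sym here = here
  reach-sym (step e h j p) = reach-trans (reach-sym p) (reach-edge h (joins-sym j))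

  reach-mono : ∀ {S S′ u v} → S ⊆ S′ → u ~[ S ] v → u ~[ S′ ] v
  reach-mono S⊆S′ here = here
  reach-mono S⊆S′ (step e h j p) = step e (S⊆S′ h) j (reach-mono S⊆S′ p)

  reach-ends : ∀ {S} e → e ∈ S → src e ~[ S ] tgt e
  reach-ends e h = reach-edge h (joins-ends e)

  reach-joins : ∀ {S e u v} → src e ~[ S ] tgt e → Joins G e u v → u ~[ S ] v
  reach-joins p (inj₁ (refl , refl)) = p
  reach-joins p (inj₂ (refl , refl)) = reach-sym p

  src-reaches-end : ∀ {e u v} → Joins G e u v → src e ~[ allEdges G ] u
  src-reaches-end (inj₁ (refl , _)) = here
  src-reaches-end {e} (inj₂ (_ , refl)) = reach-ends e (∈allEdges e)

  reach-invariant : ∀ {A : Set} {S} (f : Fin n → A) → (∀ e → e ∈ S → f (src e) ≡ f (tgt e)) →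
                    ∀ {u v} → u ~[ S ] v → f u ≡ f v
  reach-invariant f h here = refl
  reach-invariant f h (step e he (inj₁ (refl , refl)) p) = trans (h e he) (reach-invariant f h p)
  reach-invariant f h (step e he (inj₂ (refl , refl)) p) = trans (sym (h e he)) (reach-invariant f h p)

  ViaEdge : Subset m → Fin m → Fin n → Fin n → Set
  ViaEdge S′ t u v = u ~[ S′ ] v ⊎ ((u ~[ S′ ] src t ⊎ u ~[ S′ ] tgt t) × (src t ~[ S′ ] v ⊎ tgt t ~[ S′ ] v))

  reach⇒via-edge : ∀ {S S′} t → (∀ e → e ∈ S → e ≢ t → e ∈ S′) → ∀ {u v} → u ~[ S ] v → ViaEdge S′ t u v
  reach⇒via-edge t f here = inj₁ here
  reach⇒via-edge t f (step e h j p) with e ≟ t | reach⇒via-edge t f p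
  ... | no e≢t | inj₁ q = inj₁ (step e (f e h e≢t) j q)
  ... | no e≢t | inj₂ (inj₁ l , r) = inj₂ (inj₁ (step e (f e h e≢t) j l) , r)
  ... | no e≢t | inj₂ (inj₂ l , r) = inj₂ (inj₂ (step e (f e h e≢t) j l) , r)
  reach⇒via-edge t f (step e h (inj₁ (refl , refl)) p) | yes refl | inj₁ q = inj₂ (inj₁ here , inj₂ q)
  reach⇒via-edge t f (step e h (inj₂ (refl , refl)) p) | yes refl | inj₁ q = inj₂ (inj₂ here , inj₁ q)
  reach⇒via-edge t f (step e h (inj₁ (refl , refl)) p) | yes refl | inj₂ (_ , r) = inj₂ (inj₁ here , r)
  reach⇒via-edge t f (step e h (inj₂ (refl , refl)) p) | yes refl | inj₂ (_ , r) = inj₂ (inj₂ here , r)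

  via-edge⇒reach : ∀ {S′ S} t → t ∈ S → S′ ⊆ S → ∀ {u v} → ViaEdge S′ t u v → u ~[ S ] v
  via-edge⇒reach t t∈S S′⊆S (inj₁ p) = reach-mono S′⊆S p
  via-edge⇒reach t t∈S S′⊆S (inj₂ (inj₁ p , inj₁ q)) = reach-mono S′⊆S (reach-trans p q)
  via-edge⇒reach t t∈S S′⊆S (inj₂ (inj₁ p , inj₂ q)) =
    reach-trans (reach-mono S′⊆S p) (reach-trans (reach-ends t t∈S) (reach-mono S′⊆S q))
  via-edge⇒reach t t∈S S′⊆S (inj₂ (inj₂ p , inj₁ q)) =
    reach-trans (reach-mono S′⊆S p) (reach-trans (reach-sym (reach-ends t t∈S)) (reach-mono S′⊆S q))
  via-edge⇒reach t t∈S S′⊆S (inj₂ (inj₂ p , inj₂ q)) = reach-mono S′⊆S (reach-trans p q)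

  via-edge? : ∀ {S′} t → (∀ u v → Dec (u ~[ S′ ] v)) → ∀ u v → Dec (ViaEdge S′ t u v)
  via-edge? t d u v = d u v ⊎-dec ((d u _ ⊎-dec d u _) ×-dec (d _ v ⊎-dec d _ v))

  -- Reachability is decided by adding the edges of S one at a time.
  edgeSet : List (Fin m) → Subset m
  edgeSet [] = Subset.⊥
  edgeSet (e ∷ es) = ⁅ e ⁆ ∪ edgeSet es

  ∈edgeSet : ∀ {e} es → e ∈ₗ es → e ∈ edgeSet es
  ∈edgeSet (e ∷ es) (Any.here refl) = x∈p∪q⁺ (inj₁ (x∈⁅x⁆ e))
  ∈edgeSet (e ∷ es) (Any.there h) = x∈p∪q⁺ (inj₂ (∈edgeSet es h))

  private
    ∈-∩-∷ : ∀ {S e es x} → x ∈ S ∩ (⁅ e ⁆ ∪ edgeSet es) → x ∈ S × (x ≡ e ⊎ x ∈ S ∩ edgeSet es)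
    ∈-∩-∷ {S} {e} {es} h with x∈p∩q⁻ S _ h
    ... | x∈S , x∈ = x∈S , Sum.map (x∈⁅y⁆⇒x≡y e) (λ x∈es → x∈p∩q⁺ (x∈S , x∈es)) (x∈p∪q⁻ ⁅ e ⁆ (edgeSet es) x∈)

    ⊆-∩-∷ : ∀ {S e es} → S ∩ edgeSet es ⊆ S ∩ (⁅ e ⁆ ∪ edgeSet es)
    ⊆-∩-∷ {S} h with x∈p∩q⁻ S _ h
    ... | x∈S , x∈es = x∈p∩q⁺ (x∈S , x∈p∪q⁺ (inj₂ x∈es))

  reach-within? : ∀ S es u v → Dec (u ~[ S ∩ edgeSet es ] v)
  reach-within? S [] u v with u ≟ v
  ... | yes refl = yes here
  ... | no u≢v = no (λ p → u≢v (edgeless p))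
    where
    edgeless : ∀ {u v} → u ~[ S ∩ edgeSet [] ] v → u ≡ v
    edgeless here = refl
    edgeless (step e h j p) = ⊥-elim (∉⊥ (proj₂ (x∈p∩q⁻ S _ h)))
  reach-within? S (e ∷ es) u v with e ∈? S
  ... | yes e∈S = map′ (via-edge⇒reach e (x∈p∩q⁺ (e∈S , x∈p∪q⁺ (inj₁ (x∈⁅x⁆ e)))) (⊆-∩-∷ {S} {e} {es}))
                       (reach⇒via-edge e shrink) (via-edge? e (reach-within? S es) u v)
    where
    shrink : ∀ x → x ∈ S ∩ (⁅ e ⁆ ∪ edgeSet es) → x ≢ e → x ∈ S ∩ edgeSet es
    shrink x h x≢e = [ (λ x≡e → ⊥-elim (x≢e x≡e)) , (λ h′ → h′) ]′ (proj₂ (∈-∩-∷ {S} {e} {es} h))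
  ... | no e∉S = map′ (reach-mono (⊆-∩-∷ {S} {e} {es})) (reach-mono shrink) (reach-within? S es u v)
    where
    shrink : S ∩ (⁅ e ⁆ ∪ edgeSet es) ⊆ S ∩ edgeSet es
    shrink h with ∈-∩-∷ {S} {e} {es} h
    ... | x∈S , inj₁ refl = ⊥-elim (e∉S x∈S)
    ... | _ , inj₂ h′ = h′

  reach? : ∀ S u v → Dec (u ~[ S ] v)
  reach? S u v = map′ (reach-mono (λ h → proj₁ (x∈p∩q⁻ S _ h)))
                      (reach-mono (λ {e} h → x∈p∩q⁺ (h , ∈edgeSet (allFin m) (∈-allFin e))))
                      (reach-within? S (allFin m) u v)

  nextMod-< : ∀ {k} (i : Fin (suc k)) → toℕ i < k → toℕ (nextMod G i) ≡ suc (toℕ i)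
  nextMod-< i i<k = trans (toℕ-fromℕ< _) (m<n⇒m%n≡m (s≤s i<k))

  nextMod-last : ∀ {k} (i : Fin (suc k)) → toℕ i ≡ k → nextMod G i ≡ zero
  nextMod-last {k} i i≡k =
    toℕ-injective (trans (toℕ-fromℕ< _) (trans (cong (λ x → suc x % suc k) i≡k) (n%n≡0 (suc k))))

  nextMod-inject₁ : ∀ {k} (j : Fin k) → nextMod G (inject₁ j) ≡ suc j
  nextMod-inject₁ {k} j = toℕ-injective (trans (nextMod-< (inject₁ j) inject₁j<k) (cong suc (toℕ-inject₁ j)))
    where
    inject₁j<k : toℕ (inject₁ j) < k
    inject₁j<k = subst (_< k) (sym (toℕ-inject₁ j)) (toℕ<n j)

  module _ {k} (vs : Fin (suc k) → Fin n) (es : Fin (suc k) → Fin m)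
           (joins : ∀ i → Joins G (es i) (vs i) (vs (nextMod G i)))
           {S : Subset m} (inS : ∀ i → i ≢ zero → es i ∈ S) where

    private
      walk-to-start : ∀ d (i : Fin (suc k)) → i ≢ zero → toℕ i + d ≡ k → vs i ~[ S ] vs zero
      walk-to-start zero i i≢0 i≡k = step (es i) (inS i i≢0) (joins i)
        (subst (λ j → vs j ~[ S ] vs zero) (sym (nextMod-last i (trans (sym (+-identityʳ _)) i≡k))) here)
      walk-to-start (suc d) i i≢0 i+d≡k = step (es i) (inS i i≢0) (joins i) (walk-to-start d (nextMod G i) next≢0 next+d≡k)
        where
        next≡ : toℕ (nextMod G i) ≡ suc (toℕ i)
        next≡ = nextMod-< i (subst (toℕ i <_) i+d≡k (m<m+n (toℕ i) (s≤s z≤n)))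
        next≢0 : nextMod G i ≢ zero
        next≢0 e with trans (sym next≡) (cong toℕ e)
        ... | ()
        next+d≡k : toℕ (nextMod G i) + d ≡ k
        next+d≡k = trans (cong (_+ d) next≡) (trans (sym (+-suc (toℕ i) d)) i+d≡k)

    cycle-walk : vs (nextMod G zero) ~[ S ] vs zero
    cycle-walk = go k refl
      where
      go : ∀ k′ → k′ ≡ k → vs (nextMod G zero) ~[ S ] vs zero
      go zero refl = here
      go (suc k′) refl = walk-to-start k′ (suc zero) (λ ()) refl

  OnWalk : ∀ {S u v} → Fin n → u ~[ S ] v → Set
  OnWalk x (here {u}) = x ≡ u
  OnWalk x (step {u} e h j p) = x ≡ u ⊎ OnWalk x p

  on-walk? : ∀ {S u v} x (p : u ~[ S ] v) → Dec (OnWalk x p)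
  on-walk? x (here {u}) = x ≟ u
  on-walk? x (step {u} e h j p) = (x ≟ u) ⊎-dec on-walk? x p

  IsPath : ∀ {S u v} → u ~[ S ] v → Set
  IsPath here = ⊤
  IsPath (step {u} e h j p) = (¬ OnWalk u p) × IsPath p

  on-walk-start : ∀ {S u v} (p : u ~[ S ] v) → OnWalk u p
  on-walk-start here = refl
  on-walk-start (step e h j p) = inj₁ refl

  path-suffix : ∀ {S u v w} (p : v ~[ S ] w) → IsPath p → OnWalk u p → Σ (u ~[ S ] w) IsPath
  path-suffix here _ refl = here , tt
  path-suffix (step e h j p) isPath (inj₁ refl) = step e h j p , isPath
  path-suffix (step e h j p) (_ , isPath) (inj₂ onP) = path-suffix p isPath onP

  loop-erase : ∀ {S u w} (p : u ~[ S ] w) → Σ (u ~[ S ] w) IsPath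
  loop-erase here = here , tt
  loop-erase (step {u} e h j p) with loop-erase p
  ... | q , isPath with on-walk? u q
  ... | yes onQ = path-suffix q isPath onQ
  ... | no ¬onQ = step e h j q , ¬onQ , isPath

  walkLength : ∀ {S u v} → u ~[ S ] v → ℕ
  walkLength here = 0
  walkLength (step e h j p) = suc (walkLength p)

  vertexAt : ∀ {S u v} (p : u ~[ S ] v) → Fin (suc (walkLength p)) → Fin n
  vertexAt (here {u}) zero = u
  vertexAt (step {u} e h j p) zero = u
  vertexAt (step e h j p) (suc i) = vertexAt p i

  -- The edges of p followed by the closing edge t.
  edgeAt : ∀ {S u v} (p : u ~[ S ] v) → Fin m → Fin (suc (walkLength p)) → Fin m
  edgeAt here t zero = t
  edgeAt (step e h j p) t zero = e
  edgeAt (step e h j p) t (suc i) = edgeAt p t i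

  vertexAt-zero : ∀ {S u v} (p : u ~[ S ] v) → vertexAt p zero ≡ u
  vertexAt-zero here = refl
  vertexAt-zero (step e h j p) = refl

  vertexAt-last : ∀ {S u v} (p : u ~[ S ] v) → vertexAt p (fromℕ (walkLength p)) ≡ v
  vertexAt-last here = refl
  vertexAt-last (step e h j p) = vertexAt-last p

  edgeAt-last : ∀ {S u v} (p : u ~[ S ] v) t → edgeAt p t (fromℕ (walkLength p)) ≡ t
  edgeAt-last here t = refl
  edgeAt-last (step e h j p) t = edgeAt-last p t

  vertexAt-on-walk : ∀ {S u v} (p : u ~[ S ] v) i → OnWalk (vertexAt p i) p
  vertexAt-on-walk here zero = refl
  vertexAt-on-walk (step e h j p) zero = inj₁ refl
  vertexAt-on-walk (step e h j p) (suc i) = inj₂ (vertexAt-on-walk p i)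

  vertexAt-injective : ∀ {S u v} (p : u ~[ S ] v) → IsPath p → ∀ i i′ → vertexAt p i ≡ vertexAt p i′ → i ≡ i′
  vertexAt-injective here _ zero zero _ = refl
  vertexAt-injective (step e h j p) _ zero zero _ = refl
  vertexAt-injective (step e h j p) (¬onP , _) zero (suc i′) eq =
    ⊥-elim (¬onP (subst (λ x → OnWalk x p) (sym eq) (vertexAt-on-walk p i′)))
  vertexAt-injective (step e h j p) (¬onP , _) (suc i) zero eq =
    ⊥-elim (¬onP (subst (λ x → OnWalk x p) eq (vertexAt-on-walk p i)))
  vertexAt-injective (step e h j p) (_ , isPath) (suc i) (suc i′) eq = cong suc (vertexAt-injective p isPath i i′ eq)

  edgeAt-closing-or-walk : ∀ {S u v} (p : u ~[ S ] v) t i → edgeAt p t i ≡ t ⊎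
    (edgeAt p t i ∈ S × ∃[ x ] ∃[ y ] (Joins G (edgeAt p t i) x y × OnWalk x p × OnWalk y p))
  edgeAt-closing-or-walk here t zero = inj₁ refl
  edgeAt-closing-or-walk (step e h j p) t zero = inj₂ (h , _ , _ , j , inj₁ refl , inj₂ (on-walk-start p))
  edgeAt-closing-or-walk (step e h j p) t (suc i) with edgeAt-closing-or-walk p t i
  ... | inj₁ closing = inj₁ closing
  ... | inj₂ (e∈S , x , y , jxy , onx , ony) = inj₂ (e∈S , x , y , jxy , inj₂ onx , inj₂ ony)

  edgeAt-injective : ∀ {S u v} (p : u ~[ S ] v) t → t ∉ S → IsPath p → ∀ i i′ → edgeAt p t i ≡ edgeAt p t i′ → i ≡ i′
  edgeAt-injective {S} {v = v} p t t∉S isPath i i′ eq = go p isPath i i′ eq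
    where
    -- the first edge of a path cannot recur, since it would revisit the start vertex
    first-not-later : ∀ {u w} (e : Fin m) (h : e ∈ S) (j : Joins G e u w) (p : w ~[ S ] v) → ¬ OnWalk u p →
                      ∀ i′ → e ≢ edgeAt p t i′
    first-not-later e h j p ¬onP i′ eq with edgeAt-closing-or-walk p t i′
    ... | inj₁ closing = t∉S (subst (_∈ S) (trans eq closing) h)
    ... | inj₂ (_ , x , y , jxy , onx , ony) with joins-common-end j (subst (λ z → Joins G z x y) (sym eq) jxy)
    ... | inj₁ refl = ¬onP onx
    ... | inj₂ refl = ¬onP ony
    go : ∀ {u} (p : u ~[ S ] v) → IsPath p → ∀ i i′ → edgeAt p t i ≡ edgeAt p t i′ → i ≡ i′
    go here _ zero zero _ = refl
    go (step e h j p) _ zero zero _ = refl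
    go (step e h j p) (¬onP , _) zero (suc i′) eq = ⊥-elim (first-not-later e h j p ¬onP i′ eq)
    go (step e h j p) (¬onP , _) (suc i) zero eq = ⊥-elim (first-not-later e h j p ¬onP i (sym eq))
    go (step e h j p) (_ , isPath) (suc i) (suc i′) eq = cong suc (go p isPath i i′ eq)

  splitLast : ∀ {k} (i : Fin (suc k)) → i ≡ fromℕ k ⊎ ∃[ j ] i ≡ inject₁ j
  splitLast {zero} zero = inj₁ refl
  splitLast {suc k} zero = inj₂ (zero , refl)
  splitLast {suc k} (suc i) with splitLast i
  ... | inj₁ e = inj₁ (cong suc e)
  ... | inj₂ (j , e) = inj₂ (suc j , cong suc e)

  edgeAt-joins : ∀ {S u v} (p : u ~[ S ] v) t (i : Fin (walkLength p)) →
                 Joins G (edgeAt p t (inject₁ i)) (vertexAt p (inject₁ i)) (vertexAt p (suc i))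
  edgeAt-joins (step e h j p) t zero = subst (Joins G e _) (sym (vertexAt-zero p)) j
  edgeAt-joins (step e h j p) t (suc i) = edgeAt-joins p t i

  -- Loop-erase the walk and close it up with t.
  walk⇒cycle : ∀ {F S} t → t ∈ F → t ∉ S → S ⊆ F → src t ~[ S ] tgt t → HasCycle G F
  walk⇒cycle {F} {S} t t∈F t∉S S⊆F w with loop-erase w
  ... | p , isPath = walkLength p , vertexAt p , edgeAt p t ,
                     (λ {x} {y} → vertexAt-injective p isPath x y) , (λ {x} {y} → edgeAt-injective p t t∉S isPath x y) ,
                     inF , joinsNext
    where
    inF : ∀ i → edgeAt p t i ∈ F
    inF i with edgeAt-closing-or-walk p t i
    ... | inj₁ closing = subst (_∈ F) (sym closing) t∈F
    ... | inj₂ (e∈S , _) = S⊆F e∈S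
    joinsNext : ∀ i → Joins G (edgeAt p t i) (vertexAt p i) (vertexAt p (nextMod G i))
    joinsNext i with splitLast i
    ... | inj₁ refl =
      subst₂ (λ a b → Joins G a (vertexAt p (fromℕ (walkLength p))) (vertexAt p b))
             (sym (edgeAt-last p t)) (sym (nextMod-last (fromℕ (walkLength p)) (toℕ-fromℕ _)))
             (subst₂ (Joins G t) (sym (vertexAt-last p)) (sym (vertexAt-zero p)) (joins-sym (joins-ends t)))
    ... | inj₂ (j , refl) =
      subst (λ b → Joins G (edgeAt p t (inject₁ j)) (vertexAt p (inject₁ j)) (vertexAt p b))
            (sym (nextMod-inject₁ j)) (edgeAt-joins p t j)

  AllBridges : Subset m → Set
  AllBridges T = ∀ t → t ∈ T → ∀ S → S ⊆ T → t ∉ S → ¬ (src t ~[ S ] tgt t)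

  forest⇒all-bridges : ∀ {F} → IsForest G F → AllBridges F
  forest⇒all-bridges forest t t∈F S S⊆F t∉S w = forest (walk⇒cycle t t∈F t∉S S⊆F w)

  all-bridges-∪ : ∀ {T} e → AllBridges T → ¬ (src e ~[ T ] tgt e) → AllBridges (T ∪ ⁅ e ⁆)
  all-bridges-∪ {T} e bridges e-new t t∈ S S⊆ t∉S w with t ≟ e
  ... | yes refl = e-new (reach-mono S⊆T w)
    where
    S⊆T : S ⊆ T
    S⊆T h with x∈p∪q⁻ T _ (S⊆ h)
    ... | inj₁ x∈T = x∈T
    ... | inj₂ x∈⁅t⁆ = ⊥-elim (t∉S (subst (_∈ S) (x∈⁅y⁆⇒x≡y _ x∈⁅t⁆) h))
  ... | no t≢e with x∈p∪q⁻ T _ t∈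
  ... | inj₂ t∈⁅e⁆ = ⊥-elim (t≢e (x∈⁅y⁆⇒x≡y _ t∈⁅e⁆))
  ... | inj₁ t∈T = via-e (reach⇒via-edge e S∖e w)
    where
    S′ = S ∩ ∁ ⁅ e ⁆
    S∖e : ∀ x → x ∈ S → x ≢ e → x ∈ S′
    S∖e x h x≢e = x∈p∩q⁺ (h , x∉p⇒x∈∁p (λ b → x≢e (x∈⁅y⁆⇒x≡y _ b)))
    S′⊆T : S′ ⊆ T
    S′⊆T h with x∈p∩q⁻ S _ h
    ... | x∈S , x∉⁅e⁆ with x∈p∪q⁻ T _ (S⊆ x∈S)
    ... | inj₁ x∈T = x∈T
    ... | inj₂ x∈⁅e⁆ = ⊥-elim (x∈∁p⇒x∉p x∉⁅e⁆ x∈⁅e⁆)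
    ¬w′ : ¬ (src t ~[ S′ ] tgt t)
    ¬w′ = bridges t t∈T S′ S′⊆T (λ h → t∉S (proj₁ (x∈p∩q⁻ S _ h)))
    t-edge : src t ~[ T ] tgt t
    t-edge = reach-ends t t∈T
    -- a walk through e between the ends of t would join the ends of e through t
    via-e : ViaEdge S′ e (src t) (tgt t) → ⊥
    via-e (inj₁ q) = ¬w′ q
    via-e (inj₂ (inj₁ l , inj₁ r)) = ¬w′ (reach-trans l r)
    via-e (inj₂ (inj₂ l , inj₂ r)) = ¬w′ (reach-trans l r)
    via-e (inj₂ (inj₁ l , inj₂ r)) =
      e-new (reach-trans (reach-sym (reach-mono S′⊆T l)) (reach-trans t-edge (reach-sym (reach-mono S′⊆T r))))
    via-e (inj₂ (inj₂ l , inj₁ r)) =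
      e-new (reach-trans (reach-mono S′⊆T r) (reach-trans (reach-sym t-edge) (reach-mono S′⊆T l)))

  SpanningForest : Subset m → Subset m → Subset m → Set
  SpanningForest S F T = F ⊆ T × T ⊆ S × AllBridges T × (∀ e → e ∈ S → src e ~[ T ] tgt e)

  private
    SpansList : Subset m → Subset m → List (Fin m) → Set
    SpansList S T es = ∀ e → e ∈ₗ es → e ∈ S → src e ~[ T ] tgt e

    spans-∷ : ∀ {S T e es} → (e ∈ S → src e ~[ T ] tgt e) → SpansList S T es → SpansList S T (e ∷ es)
    spans-∷ spans-e spans-es x (Any.here refl) = spans-e
    spans-∷ spans-e spans-es x (Any.there h) = spans-es x h

    extend : ∀ S F → F ⊆ S → AllBridges F → (es : List (Fin m)) →
             ∃[ T ] (F ⊆ T × T ⊆ S × AllBridges T × SpansList S T es)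
    extend S F F⊆S bridges [] = F , (λ h → h) , F⊆S , bridges , λ _ ()
    extend S F F⊆S bridges (e ∷ es) with e ∈? S | reach? F (src e) (tgt e)
    ... | no e∉S | _ with extend S F F⊆S bridges es
    ...   | T , F⊆T , T⊆S , bT , spans = T , F⊆T , T⊆S , bT , spans-∷ (λ e∈S → ⊥-elim (e∉S e∈S)) spans
    extend S F F⊆S bridges (e ∷ es) | yes e∈S | yes joined with extend S F F⊆S bridges es
    ...   | T , F⊆T , T⊆S , bT , spans = T , F⊆T , T⊆S , bT , spans-∷ (λ _ → reach-mono F⊆T joined) spans
    extend S F F⊆S bridges (e ∷ es) | yes e∈S | no ¬joined
      with extend S (F ∪ ⁅ e ⁆) F∪e⊆S (all-bridges-∪ e bridges ¬joined) es
      where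
      F∪e⊆S : F ∪ ⁅ e ⁆ ⊆ S
      F∪e⊆S h with x∈p∪q⁻ F _ h
      ... | inj₁ x∈F = F⊆S x∈F
      ... | inj₂ x∈⁅e⁆ = subst (_∈ S) (sym (x∈⁅y⁆⇒x≡y _ x∈⁅e⁆)) e∈S
    ...   | T , F∪e⊆T , T⊆S , bT , spans =
      T , (λ h → F∪e⊆T (x∈p∪q⁺ (inj₁ h))) , T⊆S , bT ,
      spans-∷ (λ _ → reach-mono F∪e⊆T (reach-ends e (x∈p∪q⁺ (inj₂ (x∈⁅x⁆ e))))) spans

  spanning-forest : ∀ S F → F ⊆ S → IsForest G F → ∃[ T ] SpanningForest S F T
  spanning-forest S F F⊆S forest with extend S F F⊆S (forest⇒all-bridges forest) (allFin m)
  ... | T , F⊆T , T⊆S , bT , spans = T , F⊆T , T⊆S , bT , (λ e → spans e (∈-allFin e))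

  lookup-δ : ∀ X e → lookup (δ G X) e ≡ lookup X (src e) xor lookup X (tgt e)
  lookup-δ X e = lookup∘tabulate _ e

  same-side : ∀ X {e} → e ∉ δ G X → lookup X (src e) ≡ lookup X (tgt e)
  same-side X {e} e∉δ = xor≡false⇒≡ (trans (sym (lookup-δ X e)) (∉⇒lookup≡false e∉δ))

  crosses : ∀ X {e} → e ∈ δ G X → lookup X (src e) ≢ lookup X (tgt e)
  crosses X {e} e∈δ = xor≡true⇒≢ (trans (sym (lookup-δ X e)) (∈⇒lookup≡true e∈δ))

  crosses-joins : ∀ X {e u v} → e ∈ δ G X → Joins G e u v → lookup X u ≢ lookup X v
  crosses-joins X e∈δ (inj₁ (refl , refl)) = crosses X e∈δ
  crosses-joins X e∈δ (inj₂ (refl , refl)) = λ q → crosses X e∈δ (sym q)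

  crossing⇒∈δ : ∀ X e → lookup X (src e) ≢ lookup X (tgt e) → e ∈ δ G X
  crossing⇒∈δ X e ne = lookup≡true⇒∈ (trans (lookup-δ X e) (≢⇒xor≡true ne))

  same-side⇒∉δ : ∀ X e → lookup X (src e) ≡ lookup X (tgt e) → e ∉ δ G X
  same-side⇒∉δ X e eq = lookup≡false⇒∉ (trans (lookup-δ X e) (≡⇒xor≡false eq))

  crossing-joins⇒∈δ : ∀ X e {u v} → Joins G e u v → lookup X u ≢ lookup X v → e ∈ δ G X
  crossing-joins⇒∈δ X e (inj₁ (refl , refl)) ne = crossing⇒∈δ X e ne
  crossing-joins⇒∈δ X e (inj₂ (refl , refl)) ne = crossing⇒∈δ X e (λ q → ne (sym q))

  ∈δ⇒end-inside : ∀ X e → e ∈ δ G X → lookup X (src e) ≡ true ⊎ lookup X (tgt e) ≡ true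
  ∈δ⇒end-inside X e e∈δ with lookup X (src e) in q₁ | lookup X (tgt e) in q₂
  ... | true  | _     = inj₁ refl
  ... | false | true  = inj₂ refl
  ... | false | false = ⊥-elim (crosses X e∈δ (trans q₁ (sym q₂)))

  side-preserved : ∀ {S} X → (∀ e → e ∈ S → e ∉ δ G X) → ∀ {u v} → u ~[ S ] v → lookup X u ≡ lookup X v
  side-preserved X avoids = reach-invariant (lookup X) (λ e e∈S → same-side X (avoids e e∈S))

  δ-∁ : ∀ X → δ G (∁ X) ≡ δ G X
  δ-∁ X = tabulate-cong λ e →
    trans (cong₂ _xor_ (lookup-map (src e) not X) (lookup-map (tgt e) not X))
          (not-xor-not (lookup X (src e)) (lookup X (tgt e)))

  reachable : Subset m → Fin n → Subset n
  reachable S x = tabulate (λ v → does (reach? S x v))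

  reach⇒reachable : ∀ {S x v} → x ~[ S ] v → lookup (reachable S x) v ≡ true
  reach⇒reachable {S} {x} {v} p = trans (lookup∘tabulate _ v) (dec-true (reach? S x v) p)

  unreach⇒unreachable : ∀ {S x v} → ¬ (x ~[ S ] v) → lookup (reachable S x) v ≡ false
  unreach⇒unreachable {S} {x} {v} ¬p = trans (lookup∘tabulate _ v) (dec-false (reach? S x v) ¬p)

  reachable⇒reach : ∀ {S x v} → lookup (reachable S x) v ≡ true → x ~[ S ] v
  reachable⇒reach {S} {x} {v} h =
    decidable-stable (reach? S x v) (λ ¬p → true≢false (trans (sym h) (unreach⇒unreachable ¬p)))

  unreachable⇒unreach : ∀ {S x v} → lookup (reachable S x) v ≡ false → ¬ (x ~[ S ] v)
  unreachable⇒unreach h p = true≢false (trans (sym (reach⇒reachable p)) h)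

  reachable-closed : ∀ {S} x e → e ∈ S → e ∉ δ G (reachable S x)
  reachable-closed {S} x e e∈S = same-side⇒∉δ (reachable S x) e (by-cases (reach? S x (src e)))
    where
    e-edge = reach-ends e e∈S
    by-cases : Dec (x ~[ S ] src e) → lookup (reachable S x) (src e) ≡ lookup (reachable S x) (tgt e)
    by-cases (yes p) = trans (reach⇒reachable p) (sym (reach⇒reachable (reach-trans p e-edge)))
    by-cases (no ¬p) = trans (unreach⇒unreachable ¬p)
                             (sym (unreach⇒unreachable (λ q → ¬p (reach-trans q (reach-sym e-edge)))))

  reachable-side : ∀ {S} x {u v} → u ~[ S ] v → lookup (reachable S x) u ≡ lookup (reachable S x) v
  reachable-side x = side-preserved (reachable _ x) (λ e → reachable-closed x e)

  two-sided-cut⇒bond : ∀ X x₀ w₀ N → (∀ e → e ∈ N → e ∉ δ G X) → Nonempty (δ G X) →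
    (∀ e → e ∈ δ G X → (x₀ ~[ N ] src e × w₀ ~[ N ] tgt e) ⊎ (w₀ ~[ N ] src e × x₀ ~[ N ] tgt e)) →
    IsBond G (δ G X)
  two-sided-cut⇒bond X x₀ w₀ N N-avoids nonempty two-sided = (X , refl) , nonempty , minimal
    where
    minimal : ∀ C → IsCut G C → Nonempty C → C ⊆ δ G X → C ≡ δ G X
    minimal _ (Y , refl) (e₀ , e₀∈δY) δY⊆δX = ⊆-antisym δY⊆δX δX⊆δY
      where
      sideY : ∀ {u v} → u ~[ N ] v → lookup Y u ≡ lookup Y v
      sideY = side-preserved Y (λ f f∈N f∈δY → N-avoids f f∈N (δY⊆δX f∈δY))
      separated : lookup Y x₀ ≢ lookup Y w₀
      separated with two-sided e₀ (δY⊆δX e₀∈δY)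
      ... | inj₁ (p , q) = λ eq → crosses Y e₀∈δY (trans (sym (sideY p)) (trans eq (sideY q)))
      ... | inj₂ (p , q) = λ eq → crosses Y e₀∈δY (trans (sym (sideY p)) (trans (sym eq) (sideY q)))
      δX⊆δY : δ G X ⊆ δ G Y
      δX⊆δY {e} e∈δX with two-sided e e∈δX
      ... | inj₁ (p , q) = crossing⇒∈δ Y e (λ eq → separated (trans (sideY p) (trans eq (sym (sideY q)))))
      ... | inj₂ (p , q) = crossing⇒∈δ Y e (λ eq → separated (trans (sideY q) (trans (sym eq) (sym (sideY p)))))

  module FundamentalCut (T : Subset m) (t : Fin m) (t∈T : t ∈ T) (bridges : AllBridges T) (a b : Fin n)
                        (t-ab : (src t ≡ a × tgt t ≡ b) ⊎ (src t ≡ b × tgt t ≡ a)) where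
    N = T ∩ ∁ ⁅ t ⁆
    P = reachable N a

    N⊆T : N ⊆ T
    N⊆T h = proj₁ (x∈p∩q⁻ T _ h)

    t∉N : t ∉ N
    t∉N h = x∈∁p⇒x∉p (proj₂ (x∈p∩q⁻ T _ h)) (x∈⁅x⁆ t)

    ∈N : ∀ e → e ∈ T → e ≢ t → e ∈ N
    ∈N e e∈T e≢t = x∈p∩q⁺ (e∈T , x∉p⇒x∈∁p (λ q → e≢t (x∈⁅y⁆⇒x≡y _ q)))

    a≁b : ¬ (a ~[ N ] b)
    a≁b p = [ (λ { (refl , refl) → bridges t t∈T N N⊆T t∉N p })
            , (λ { (refl , refl) → bridges t t∈T N N⊆T t∉N (reach-sym p) }) ]′ t-ab

    P-a : lookup P a ≡ true
    P-a = reach⇒reachable here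

    P-b : lookup P b ≡ false
    P-b = unreach⇒unreachable a≁b

    t∈δP : t ∈ δ G P
    t∈δP = crossing-joins⇒∈δ P t t-ab (λ q → true≢false (trans (sym P-a) (trans q P-b)))

    N∉δP : ∀ e → e ∈ N → e ∉ δ G P
    N∉δP e = reachable-closed a e

    sideP : ∀ {u v} → u ~[ N ] v → lookup P u ≡ lookup P v
    sideP = reachable-side a

    δP∩T : ∀ e → e ∈ δ G P → e ∈ T → e ≡ t
    δP∩T e e∈δP e∈T with e ≟ t
    ... | yes e≡t = e≡t
    ... | no e≢t = ⊥-elim (N∉δP e (∈N e e∈T e≢t) e∈δP)

    from-ends : ∀ {w} → src t ~[ N ] w ⊎ tgt t ~[ N ] w → a ~[ N ] w ⊎ b ~[ N ] w
    from-ends {w} = [ (λ { (refl , refl) → λ h → h }) , (λ { (refl , refl) → Sum.swap }) ]′ t-ab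

    to-ends : ∀ {w} → w ~[ N ] src t ⊎ w ~[ N ] tgt t → w ~[ N ] a ⊎ w ~[ N ] b
    to-ends {w} = [ (λ { (refl , refl) → λ h → h }) , (λ { (refl , refl) → Sum.swap }) ]′ t-ab

    outside-from-b : ∀ {w} → a ~[ T ] w → lookup P w ≡ false → b ~[ N ] w
    outside-from-b p w∉P with reach⇒via-edge t ∈N p
    ... | inj₁ q = ⊥-elim (unreachable⇒unreach w∉P q)
    ... | inj₂ (_ , q) with from-ends q
    ...   | inj₁ q′ = ⊥-elim (unreachable⇒unreach w∉P q′)
    ...   | inj₂ q′ = q′

    δP-two-sided : ∀ e → e ∈ δ G P → src e ~[ T ] tgt e →
                   (a ~[ N ] src e × b ~[ N ] tgt e) ⊎ (b ~[ N ] src e × a ~[ N ] tgt e)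
    δP-two-sided e e∈δP spanned with lookup P (src e) in q₁ | lookup P (tgt e) in q₂
    ... | true  | true  = ⊥-elim (crosses P e∈δP (trans q₁ (sym q₂)))
    ... | false | false = ⊥-elim (crosses P e∈δP (trans q₁ (sym q₂)))
    ... | true  | false = inj₁ (reachable⇒reach q₁ ,
                                outside-from-b (reach-trans (reach-mono N⊆T (reachable⇒reach q₁)) spanned) q₂)
    ... | false | true  = inj₂ (outside-from-b (reach-trans (reach-mono N⊆T (reachable⇒reach q₂)) (reach-sym spanned)) q₁ ,
                                reachable⇒reach q₂)

    δP-bond : (∀ e → e ∈ δ G P → src e ~[ T ] tgt e) → IsBond G (δ G P)
    δP-bond spanned = two-sided-cut⇒bond P a b N N∉δP (t , t∈δP) (λ e e∈δP → δP-two-sided e e∈δP (spanned e e∈δP))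

  edge-between⇒∈δ : ∀ {X Y e u v} → Disjoint G X Y → u ∈ X → v ∈ Y → Joins G e u v → e ∈ δ G X
  edge-between⇒∈δ {X} {e = e} {v = v} disjoint u∈X v∈Y j =
    crossing-joins⇒∈δ X e j (λ q → disjoint v (lookup≡true⇒∈ (trans (sym q) (∈⇒lookup≡true u∈X))) v∈Y)

  edge-between⇒∈δ′ : ∀ {X Y e u v} → Disjoint G X Y → u ∈ X → v ∈ Y → Joins G e u v → e ∈ δ G Y
  edge-between⇒∈δ′ disjoint u∈X v∈Y j =
    edge-between⇒∈δ (λ w w∈Y w∈X → disjoint w w∈X w∈Y) v∈Y u∈X (joins-sym j)

  cocircuit-edge-cut : ∀ L D → J₀Cocircuit G L D → ∀ x → suc x ∈ D →
                       ∃[ X ] (x ∈ δ G X × (∀ {e} → e ∈ δ G X → suc e ∈ D))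
  cocircuit-edge-cut L _ (inj₁ (_ , ((X , refl) , _) , _ , refl)) x x∈D = X , drop-there x∈D , there
  cocircuit-edge-cut L _ (inj₂ (inj₁ (_ , ((X , refl) , _) , _ , refl))) x x∈D = X , drop-there x∈D , there
  cocircuit-edge-cut L _ (inj₂ (inj₂ (_ , inj₁ (X₁ , X₂ , X₃ , _ , refl) , _ , refl))) x x∈D
    with x∈p∪q⁻ (δ G X₁) _ (drop-there x∈D)
  ... | inj₁ x∈δ₁ = X₁ , x∈δ₁ , λ e∈ → there (x∈p∪q⁺ (inj₁ e∈))
  ... | inj₂ x∈δ₂₃ with x∈p∪q⁻ (δ G X₂) _ x∈δ₂₃
  ...   | inj₁ x∈δ₂ = X₂ , x∈δ₂ , λ e∈ → there (x∈p∪q⁺ (inj₂ (x∈p∪q⁺ (inj₁ e∈))))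
  ...   | inj₂ x∈δ₃ = X₃ , x∈δ₃ , λ e∈ → there (x∈p∪q⁺ (inj₂ (x∈p∪q⁺ (inj₂ e∈))))
  cocircuit-edge-cut L _ (inj₂ (inj₂ (_ , inj₂ (_ , _ , ((((X , refl) , _) , ((Y , refl) , _) , _) , refl) , _) , _ , refl))) x x∈D
    with x∈p∪q⁻ (δ G X) _ (drop-there x∈D)
  ... | inj₁ x∈δX = X , x∈δX , λ e∈ → there (x∈p∪q⁺ (inj₁ e∈))
  ... | inj₂ x∈δY = Y , x∈δY , λ e∈ → there (x∈p∪q⁺ (inj₂ e∈))

  cocircuit-has-edge : ∀ L D → J₀Cocircuit G L D → ∃[ x ] suc x ∈ D
  cocircuit-has-edge L _ (inj₁ (_ , (_ , (x , x∈B) , _) , _ , refl)) = x , there x∈B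
  cocircuit-has-edge L _ (inj₂ (inj₁ (_ , (_ , (x , x∈B) , _) , _ , refl))) = x , there x∈B
  cocircuit-has-edge L _ (inj₂ (inj₂ (_ , inj₁ (_ , _ , _ , (_ , d₁₂ , _ , _ , _ , _ , _ , (e , _ , _ , u∈ , v∈ , j) , _) , refl) , _ , refl))) =
    e , there (x∈p∪q⁺ (inj₁ (edge-between⇒∈δ d₁₂ u∈ v∈ j)))
  cocircuit-has-edge L _ (inj₂ (inj₂ (_ , inj₂ (_ , _ , (((_ , (x , x∈B₁) , _) , _) , refl) , _) , _ , refl))) =
    x , there (x∈p∪q⁺ (inj₁ x∈B₁))

  spanned-edge-meets-cut : ∀ T X {e} → src e ~[ T ] tgt e → e ∈ δ G X → ¬ (∀ t → t ∈ T → t ∉ δ G X)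
  spanned-edge-meets-cut T X p e∈δ T-avoids = crosses X e∈δ (side-preserved X T-avoids p)

  module _ (L : Subset m → Bool) where

    cocircuit-∋ : ∀ B D x → CocircuitFree G L B → J₀Cocircuit G L D → D ⊆ ⁅ x ⁆ ∪ B → x ∈ D
    cocircuit-∋ B D x free D-coc D⊆ with x ∈? D
    ... | yes x∈D = x∈D
    ... | no x∉D = ⊥-elim (free D D-coc (λ {y} y∈D → ∈⁅x⁆∪⇒∈ (D⊆ y∈D) (λ q → x∉D (subst (_∈ D) q y∈D))))

    independent⇒forest : ∀ b F → J₀Independent G L (b ∷ F) → IsForest G F
    independent⇒forest b F (B , disjoint , free , maximal) (k , vs , es , _ , es-inj , inF , joins) =
      crosses-joins X x∈δX (joins zero) (sym (side-preserved X (λ _ → x∈∁p⇒x∉p) (cycle-walk vs es joins off-cut)))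
      where
      x = es zero
      fundamental : ∃[ D ] (J₀Cocircuit G L D × D ⊆ ⁅ suc x ⁆ ∪ B)
      fundamental = maximal (suc x) (λ x∈B → disjoint (suc x) x∈B (there (inF zero)))
      D = proj₁ fundamental
      D-coc = proj₁ (proj₂ fundamental)
      D⊆ = proj₂ (proj₂ fundamental)
      cut = cocircuit-edge-cut L D D-coc x (cocircuit-∋ B D (suc x) free D-coc D⊆)
      X = proj₁ cut
      x∈δX = proj₁ (proj₂ cut)
      off-cut : ∀ i → i ≢ zero → es i ∈ ∁ (δ G X)
      off-cut i i≢0 = x∉p⇒x∈∁p λ e∈δ →
        disjoint (suc (es i)) (∈⁅x⁆∪⇒∈ (D⊆ (proj₂ (proj₂ cut) e∈δ)) (λ q → i≢0 (es-inj (suc-injective q))))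
                 (there (inF i))

    independent⇒un-cobalanced : ∀ F → J₀Independent G L (inside ∷ F) → UnCobalanced G L F
    independent⇒un-cobalanced F (B , disjoint , free , maximal) with maximal zero (λ e₀∈B → disjoint zero e₀∈B here)
    ... | D , D-coc , D⊆ with cocircuit-∋ B D zero free D-coc D⊆ | D-coc
    ...   | () | inj₁ (_ , _ , _ , refl)
    ...   | () | inj₂ (inj₂ (_ , _ , _ , refl))
    ...   | _  | inj₂ (inj₁ (B₀ , B₀-bond@((X , refl) , _) , B₀∉L , refl)) = B₀ , B₀-bond , in-ext , B₀∉L
      where
      F-avoids : ∀ f → f ∈ F → f ∉ δ G X
      F-avoids f f∈F f∈δ = disjoint (suc f) (∈⁅x⁆∪⇒∈ {x = zero} (D⊆ (there f∈δ)) (λ ())) (there f∈F)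
      in-ext : ∀ e → e ∈ δ G X → InExt G F e
      in-ext e e∈δ p = crosses X e∈δ (side-preserved X F-avoids p)

    independent⇒forest-form : ∀ I → J₀Independent G L I →
      (∃[ F ] (IsForest G F × I ≡ outside ∷ F)) ⊎ (∃[ F ] (IsForest G F × UnCobalanced G L F × I ≡ inside ∷ F))
    independent⇒forest-form (outside ∷ F) ind = inj₁ (F , independent⇒forest outside F ind , refl)
    independent⇒forest-form (inside ∷ F) ind =
      inj₂ (F , independent⇒forest inside F ind , independent⇒un-cobalanced F ind , refl)

    bond-cocircuit : ∀ B → IsBond G B → J₀Cocircuit G L (not (L B) ∷ B)
    bond-cocircuit B B-bond with L B in B∈?L
    ... | true  = inj₁ (B , B-bond , B∈?L , refl)
    ... | false = inj₂ (inj₁ (B , B-bond , B∈?L , refl))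

    -- With T a maximal forest containing F, the complement of T (and e₀) is a basis of the dual.
    forest⇒independent : ∀ F → IsForest G F → J₀Independent G L (outside ∷ F)
    forest⇒independent F forest with spanning-forest (allEdges G) F ⊆allEdges forest
    ... | T , F⊆T , _ , bridges , spans = (inside ∷ ∁ T) , disjoint , free , maximal
      where
      disjoint : Disjoint G (inside ∷ ∁ T) (outside ∷ F)
      disjoint zero _ ()
      disjoint (suc e) e∈∁T e∈F = x∈∁p⇒x∉p (drop-there e∈∁T) (F⊆T (drop-there e∈F))
      free : CocircuitFree G L (inside ∷ ∁ T)
      free D D-coc D⊆ with cocircuit-has-edge L D D-coc
      ... | x , x∈D with cocircuit-edge-cut L D D-coc x x∈D
      ...   | X , x∈δX , δX⊆D = spanned-edge-meets-cut T X (spans x (∈allEdges x)) x∈δX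
                                  (λ t t∈T t∈δ → x∈∁p⇒x∉p (drop-there (D⊆ (δX⊆D t∈δ))) t∈T)
      maximal : ∀ x → x ∉ (inside ∷ ∁ T) → ∃[ D ] (J₀Cocircuit G L D × D ⊆ ⁅ x ⁆ ∪ (inside ∷ ∁ T))
      maximal zero e₀∉ = ⊥-elim (e₀∉ here)
      maximal (suc t) t∉ = _ , bond-cocircuit (δ G P) (δP-bond (λ e _ → spans e (∈allEdges e))) ,
                           ⊆-edge∪∁ t (δ G P) T (λ _ → refl) δP∩T
        where
        open FundamentalCut T t (x∉∁p⇒x∈p (λ h → t∉ (there h))) bridges (src t) (tgt t) (inj₁ (refl , refl))

  Covered : Subset m → List (Fin n) → Fin n → Set
  Covered S rs w = ∃[ i ] List.lookup rs i ~[ S ] w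

  Separated : Subset m → List (Fin n) → Set
  Separated S rs = ∀ i j → List.lookup rs i ~[ S ] List.lookup rs j → i ≡ j

  private
    collect : ∀ S (ps : List (Fin n)) rs → Separated S rs →
              ∃[ rs′ ] (Separated S rs′ × (∀ w → w ∈ₗ ps ⊎ Covered S rs w → Covered S rs′ w))
    collect S [] rs sep = rs , sep , λ { w (inj₂ c) → c ; w (inj₁ ()) }
    collect S (p ∷ ps) rs sep with any? (λ i → reach? S (List.lookup rs i) p)
    ... | yes covered with collect S ps rs sep
    ...   | rs′ , sep′ , covers = rs′ , sep′ , covers′
      where
      covers′ : ∀ w → w ∈ₗ p ∷ ps ⊎ Covered S rs w → Covered S rs′ w
      covers′ w (inj₁ (Any.here refl)) = covers w (inj₂ covered)
      covers′ w (inj₁ (Any.there h)) = covers w (inj₁ h)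
      covers′ w (inj₂ c) = covers w (inj₂ c)
    collect S (p ∷ ps) rs sep | no uncovered with collect S ps (p ∷ rs) sep′
      where
      sep′ : Separated S (p ∷ rs)
      sep′ zero zero _ = refl
      sep′ zero (suc j) q = ⊥-elim (uncovered (j , reach-sym q))
      sep′ (suc i) zero q = ⊥-elim (uncovered (i , q))
      sep′ (suc i) (suc j) q = cong suc (sep i j q)
    ... | rs′ , sep″ , covers = rs′ , sep″ , covers′
      where
      covers′ : ∀ w → w ∈ₗ p ∷ ps ⊎ Covered S rs w → Covered S rs′ w
      covers′ w (inj₁ (Any.here refl)) = covers w (inj₂ (zero , here))
      covers′ w (inj₁ (Any.there h)) = covers w (inj₁ h)
      covers′ w (inj₂ (i , q)) = covers w (inj₂ (suc i , q))

  components-exist : ∀ S → ∃[ k ] HasComponents G S k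
  components-exist S with collect S (allFin n) [] (λ ())
  ... | rs , sep , covers = List.length rs , List.lookup rs ,
                            (λ {i} {j} e → sep i j (subst (_ ~[ S ]_) e here)) , sep ,
                            λ v → covers v (inj₁ (∈-allFin v))

  components-unique : ∀ S {k₁ k₂} → HasComponents G S k₁ → HasComponents G S k₂ → k₁ ≡ k₂
  components-unique S c₁ c₂ = ≤-antisym (injective⇒≤ (component-of c₁ c₂)) (injective⇒≤ (component-of c₂ c₁))
    where
    component-of : ∀ {k k′} (c : HasComponents G S k) (c′ : HasComponents G S k′) →
                   Injective _≡_ _≡_ (λ i → proj₁ (proj₂ (proj₂ (proj₂ c′)) (proj₁ c i)))
    component-of (r , _ , sep , _) (r′ , _ , _ , cover′) {i} {j} e with cover′ (r i) | cover′ (r j)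
    ... | (x , p) | (y , q) = sep i j (reach-trans (reach-sym p) (subst (λ z → r′ z ~[ S ] r j) (sym e) q))

  components-resp : ∀ {S S′ k} → S ⊆ S′ → S′ ⊆ S → HasComponents G S k → HasComponents G S′ k
  components-resp S⊆S′ S′⊆S (r , r-inj , sep , cover) =
    r , r-inj , (λ i j p → sep i j (reach-mono S′⊆S p)) , (λ v → proj₁ (cover v) , reach-mono S⊆S′ (proj₂ (cover v)))

  -- Cutting δX inside the component of e* splits that component, and only that one, in two.
  components-split : ∀ {S S′ k} X e* → HasComponents G S k → S′ ⊆ S → (∀ e → e ∈ S′ → e ∉ δ G X) →
    (∀ u v → u ~[ S ] v → lookup X u ≡ lookup X v → u ~[ S′ ] v) →
    e* ∈ S → e* ∈ δ G X →
    (∀ u v → u ~[ S ] v → lookup X u ≢ lookup X v → src e* ~[ S ] u) →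
    HasComponents G S′ (suc k)
  components-split {S} {S′} {k} X e* (r , _ , sep , cover) S′⊆S S′-avoids same-side-joined e*∈S e*∈δ split-at-e* =
    r′ , (λ {i} {j} e → sep′ i j (subst (_ ~[ S′ ]_) e here)) , sep′ , cover′
    where
    i₀ = proj₁ (cover (src e*))
    r₀~c : r i₀ ~[ S ] src e*
    r₀~c = proj₂ (cover (src e*))
    -- a vertex near e* on the other side from the old representative r i₀
    other : ∃[ w ] (src e* ~[ S ] w × lookup X w ≢ lookup X (r i₀))
    other with lookup X (src e*) ≟ᵇ lookup X (r i₀)
    ... | no ne = src e* , here , ne
    ... | yes eq = tgt e* , reach-ends e* e*∈S , λ q → crosses X e*∈δ (trans eq (sym q))
    w = proj₁ other
    c~w = proj₁ (proj₂ other)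
    w-side = proj₂ (proj₂ other)
    r′ : Fin (suc k) → Fin n
    r′ zero = w
    r′ (suc i) = r i
    sideX : ∀ {u v} → u ~[ S′ ] v → lookup X u ≡ lookup X v
    sideX = side-preserved X S′-avoids
    w≁r : ∀ j → ¬ (w ~[ S′ ] r j)
    w≁r j q with sep i₀ j (reach-trans r₀~c (reach-trans c~w (reach-mono S′⊆S q)))
    ... | refl = w-side (sideX q)
    sep′ : ∀ i j → r′ i ~[ S′ ] r′ j → i ≡ j
    sep′ zero zero _ = refl
    sep′ zero (suc j) q = ⊥-elim (w≁r j q)
    sep′ (suc i) zero q = ⊥-elim (w≁r i (reach-sym q))
    sep′ (suc i) (suc j) q = cong suc (sep i j (reach-mono S′⊆S q))
    cover′ : ∀ v → ∃[ i ] r′ i ~[ S′ ] v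
    cover′ v with cover v
    ... | i , q with lookup X (r i) ≟ᵇ lookup X v
    ...   | yes eq = suc i , same-side-joined _ _ q eq
    ...   | no ne with sep i₀ i (reach-trans r₀~c (split-at-e* _ _ q ne))
    ...     | refl = zero , same-side-joined _ _ (reach-trans (reach-sym c~w) (reach-trans (reach-sym r₀~c) q))
                                                (bool-third w-side ne)

  -- Cuts inside D are determined by their sides on finitely many anchor pairs, when every edge
  -- of D joins the N-components of some anchor pair and N avoids D.
  module CutSignatures (D N : Subset m) {j : ℕ} (fst snd : Fin j → Fin n) (N-avoids : ∀ e → e ∈ N → e ∉ D)
    (anchored : ∀ e → e ∈ D → ∃[ i ] ((fst i ~[ N ] src e × snd i ~[ N ] tgt e) ⊎ (snd i ~[ N ] src e × fst i ~[ N ] tgt e)))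
    where

    signature : Subset n → Fin j → Bool
    signature Z i = lookup Z (fst i) xor lookup Z (snd i)

    lookup-δ-signature : ∀ Z → δ G Z ⊆ D → ∀ e → (e∈D : e ∈ D) → lookup (δ G Z) e ≡ signature Z (proj₁ (anchored e e∈D))
    lookup-δ-signature Z δZ⊆D e e∈D with anchored e e∈D
    ... | i , inj₁ (p , q) = trans (lookup-δ Z e) (cong₂ _xor_ (sym (sideZ p)) (sym (sideZ q)))
      where sideZ = side-preserved Z (λ f f∈N f∈δZ → N-avoids f f∈N (δZ⊆D f∈δZ))
    ... | i , inj₂ (p , q) = trans (lookup-δ Z e) (trans (cong₂ _xor_ (sym (sideZ p)) (sym (sideZ q)))
                                                          (xor-comm (lookup Z (snd i)) (lookup Z (fst i))))
      where sideZ = side-preserved Z (λ f f∈N f∈δZ → N-avoids f f∈N (δZ⊆D f∈δZ))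

    δ-≡-by-signature : ∀ Z W → δ G Z ⊆ D → δ G W ⊆ D → (∀ i → signature Z i ≡ signature W i) → δ G Z ≡ δ G W
    δ-≡-by-signature Z W δZ⊆D δW⊆D same = ⊆-antisym (transfer Z W δZ⊆D δW⊆D same) (transfer W Z δW⊆D δZ⊆D (λ i → sym (same i)))
      where
      transfer : ∀ Z W → δ G Z ⊆ D → δ G W ⊆ D → (∀ i → signature Z i ≡ signature W i) → δ G Z ⊆ δ G W
      transfer Z W δZ⊆D δW⊆D same {e} e∈δZ = lookup≡true⇒∈
        (trans (lookup-δ-signature W δW⊆D e (δZ⊆D e∈δZ))
               (trans (sym (same _)) (trans (sym (lookup-δ-signature Z δZ⊆D e (δZ⊆D e∈δZ))) (∈⇒lookup≡true e∈δZ))))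

    signature-true⇒⊇ : ∀ Z → δ G Z ⊆ D → (∀ i → signature Z i ≡ true) → D ⊆ δ G Z
    signature-true⇒⊇ Z δZ⊆D all-true {e} e∈D = lookup≡true⇒∈ (trans (lookup-δ-signature Z δZ⊆D e e∈D) (all-true _))

    signature-false⇒empty : ∀ Z → δ G Z ⊆ D → (∀ i → signature Z i ≡ false) → ¬ Nonempty (δ G Z)
    signature-false⇒empty Z δZ⊆D all-false (e , e∈δZ) =
      lookup≡false⇒∉ (trans (lookup-δ-signature Z δZ⊆D e (δZ⊆D e∈δZ)) (all-false _)) e∈δZ

  reachable-induces-walks : ∀ N x {w u} → x ~[ N ] w → w ~[ N ] u → w ~[ inducedEdges G (reachable N x) ] u
  reachable-induces-walks N x p here = here
  reachable-induces-walks N x {w} p (step f f∈N j q) =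
    step f (induced j (reach⇒reachable (reach-trans p (reach-edge f∈N j))))
           j (reachable-induces-walks N x (reach-trans p (reach-edge f∈N j)) q)
    where
    C = reachable N x
    w∈C : lookup C w ≡ true
    w∈C = reach⇒reachable p
    induced : ∀ {u′} → Joins G f w u′ → lookup C u′ ≡ true → f ∈ inducedEdges G C
    induced (inj₁ (refl , refl)) u′∈C = lookup≡true⇒∈ (trans (lookup∘tabulate _ f) (cong₂ _∧_ w∈C u′∈C))
    induced (inj₂ (refl , refl)) u′∈C = lookup≡true⇒∈ (trans (lookup∘tabulate _ f) (cong₂ _∧_ u′∈C w∈C))

  reachable-connected : ∀ N x → InducesConnected G (reachable N x)
  reachable-connected N x = (x , lookup≡true⇒∈ (reach⇒reachable here)) , λ u v u∈ v∈ →
    reachable-induces-walks N x (reachable⇒reach (∈⇒lookup≡true u∈))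
      (reach-trans (reach-sym (reachable⇒reach (∈⇒lookup≡true u∈))) (reachable⇒reach (∈⇒lookup≡true v∈)))

  module TripartitionFacts (X₁ X₂ X₃ : Subset n) (tp : IsTripartition G X₁ X₂ X₃) where
    Tr = δ G X₁ ∪ δ G X₂ ∪ δ G X₃
    U = X₁ ∪ X₂ ∪ X₃

    private
      component = proj₁ tp
      d₁₂ = proj₁ (proj₂ tp)
      d₁₃ = proj₁ (proj₂ (proj₂ tp))
      d₂₃ = proj₁ (proj₂ (proj₂ (proj₂ tp)))
      c₁ = proj₁ (proj₂ (proj₂ (proj₂ (proj₂ tp))))
      c₂ = proj₁ (proj₂ (proj₂ (proj₂ (proj₂ (proj₂ tp)))))
      c₃ = proj₁ (proj₂ (proj₂ (proj₂ (proj₂ (proj₂ (proj₂ tp))))))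
      b₁₂ = proj₁ (proj₂ (proj₂ (proj₂ (proj₂ (proj₂ (proj₂ (proj₂ tp)))))))
      b₁₃ = proj₁ (proj₂ (proj₂ (proj₂ (proj₂ (proj₂ (proj₂ (proj₂ (proj₂ tp))))))))
      b₂₃ = proj₂ (proj₂ (proj₂ (proj₂ (proj₂ (proj₂ (proj₂ (proj₂ (proj₂ tp))))))))

    part : Fin 3 → Subset n
    part zero = X₁
    part (suc zero) = X₂
    part (suc (suc zero)) = X₃

    parts-disjoint : ∀ i k → i ≢ k → Disjoint G (part i) (part k)
    parts-disjoint zero zero ne = ⊥-elim (ne refl)
    parts-disjoint zero (suc zero) _ = d₁₂
    parts-disjoint zero (suc (suc zero)) _ = d₁₃
    parts-disjoint (suc zero) zero _ v a b = d₁₂ v b a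
    parts-disjoint (suc zero) (suc zero) ne = ⊥-elim (ne refl)
    parts-disjoint (suc zero) (suc (suc zero)) _ = d₂₃
    parts-disjoint (suc (suc zero)) zero _ v a b = d₁₃ v b a
    parts-disjoint (suc (suc zero)) (suc zero) _ v a b = d₂₃ v b a
    parts-disjoint (suc (suc zero)) (suc (suc zero)) ne = ⊥-elim (ne refl)

    private
      flip-edge : ∀ {X Y} → EdgeBetween G X Y → EdgeBetween G Y X
      flip-edge (e , u , v , u∈ , v∈ , j) = e , v , u , v∈ , u∈ , joins-sym j

    edge-between : ∀ i k → i ≢ k → EdgeBetween G (part i) (part k)
    edge-between zero zero ne = ⊥-elim (ne refl)
    edge-between zero (suc zero) _ = b₁₂
    edge-between zero (suc (suc zero)) _ = b₁₃
    edge-between (suc zero) zero _ = flip-edge b₁₂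
    edge-between (suc zero) (suc zero) ne = ⊥-elim (ne refl)
    edge-between (suc zero) (suc (suc zero)) _ = b₂₃
    edge-between (suc (suc zero)) zero _ = flip-edge b₁₃
    edge-between (suc (suc zero)) (suc zero) _ = flip-edge b₂₃
    edge-between (suc (suc zero)) (suc (suc zero)) ne = ⊥-elim (ne refl)

    part-connected : ∀ i → InducesConnected G (part i)
    part-connected zero = c₁
    part-connected (suc zero) = c₂
    part-connected (suc (suc zero)) = c₃

    part-of : ∀ {v} → v ∈ U → ∃[ i ] v ∈ part i
    part-of {v} v∈U with x∈p∪q⁻ X₁ _ v∈U
    ... | inj₁ v∈₁ = zero , v∈₁
    ... | inj₂ v∈₂₃ with x∈p∪q⁻ X₂ _ v∈₂₃
    ...   | inj₁ v∈₂ = suc zero , v∈₂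
    ...   | inj₂ v∈₃ = suc (suc zero) , v∈₃

    induced-same-side : ∀ i e → e ∈ inducedEdges G (part i) → ∀ k → lookup (part k) (src e) ≡ lookup (part k) (tgt e)
    induced-same-side i e e∈ind k with i ≟ k
    ... | yes refl = trans s∈ (sym t∈)
      where
      ends-in = trans (sym (lookup∘tabulate _ e)) (∈⇒lookup≡true e∈ind)
      s∈ = ∧-conicalˡ _ _ ends-in
      t∈ = ∧-conicalʳ _ _ ends-in
    ... | no i≢k = trans (∉⇒lookup≡false (parts-disjoint i k i≢k _ (lookup≡true⇒∈ s∈)))
                         (sym (∉⇒lookup≡false (parts-disjoint i k i≢k _ (lookup≡true⇒∈ t∈))))
      where
      ends-in = trans (sym (lookup∘tabulate _ e)) (∈⇒lookup≡true e∈ind)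
      s∈ = ∧-conicalˡ _ _ ends-in
      t∈ = ∧-conicalʳ _ _ ends-in

    induced-off-Tr : ∀ i e → e ∈ inducedEdges G (part i) → e ∉ Tr
    induced-off-Tr i e e∈ind e∈Tr with x∈p∪q⁻ (δ G X₁) _ e∈Tr
    ... | inj₁ e∈δ₁ = same-side⇒∉δ X₁ e (induced-same-side i e e∈ind zero) e∈δ₁
    ... | inj₂ e∈δ₂₃ with x∈p∪q⁻ (δ G X₂) _ e∈δ₂₃
    ...   | inj₁ e∈δ₂ = same-side⇒∉δ X₂ e (induced-same-side i e e∈ind (suc zero)) e∈δ₂
    ...   | inj₂ e∈δ₃ = same-side⇒∉δ X₃ e (induced-same-side i e e∈ind (suc (suc zero))) e∈δ₃

    within-part : ∀ i {u v} → u ∈ part i → v ∈ part i → u ~[ ∁ Tr ] v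
    within-part i u∈ v∈ = reach-mono (λ {e} e∈ind → x∉p⇒x∈∁p (induced-off-Tr i e e∈ind)) (proj₂ (part-connected i) _ _ u∈ v∈)

    U-linked : ∀ {p q} → p ∈ U → q ∈ U →
      p ~[ ∁ Tr ] q ⊎ ∃[ e ] ∃[ u ] ∃[ v ] (Joins G e u v × p ~[ ∁ Tr ] u × v ~[ ∁ Tr ] q)
    U-linked p∈ q∈ with part-of p∈ | part-of q∈
    ... | i , p∈i | k , q∈k with i ≟ k
    ...   | yes refl = inj₁ (within-part i p∈i q∈k)
    ...   | no i≢k with edge-between i k i≢k
    ...     | e , u , v , u∈ , v∈ , j = inj₂ (e , u , v , j , within-part i p∈i u∈ , within-part k v∈ q∈k)

    private
      in-U : ∀ i {v} → v ∈ part i → v ∈ U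
      in-U zero h = x∈p∪q⁺ (inj₁ h)
      in-U (suc zero) h = x∈p∪q⁺ (inj₂ (x∈p∪q⁺ (inj₁ h)))
      in-U (suc (suc zero)) h = x∈p∪q⁺ (inj₂ (x∈p∪q⁺ (inj₂ h)))
      end-in : ∀ X {e} → e ∈ δ G X → src e ∈ X ⊎ tgt e ∈ X
      end-in X {e} e∈δ = Sum.map lookup≡true⇒∈ lookup≡true⇒∈ (∈δ⇒end-inside X e e∈δ)

    Tr-edge-touches-U : ∀ e → e ∈ Tr → src e ∈ U ⊎ tgt e ∈ U
    Tr-edge-touches-U e e∈Tr with x∈p∪q⁻ (δ G X₁) _ e∈Tr
    ... | inj₁ e∈δ₁ = Sum.map (in-U zero) (in-U zero) (end-in X₁ e∈δ₁)
    ... | inj₂ e∈δ₂₃ with x∈p∪q⁻ (δ G X₂) _ e∈δ₂₃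
    ...   | inj₁ e∈δ₂ = Sum.map (in-U (suc zero)) (in-U (suc zero)) (end-in X₂ e∈δ₂)
    ...   | inj₂ e∈δ₃ = Sum.map (in-U (suc (suc zero))) (in-U (suc (suc zero))) (end-in X₃ e∈δ₃)

    Tr-edge-reaches-U : ∀ e → e ∈ Tr → ∀ {v} → src e ~[ allEdges G ] v → v ∈ U
    Tr-edge-reaches-U e e∈Tr p with Tr-edge-touches-U e e∈Tr
    ... | inj₁ s∈U = proj₂ (proj₂ component _ _ s∈U) p
    ... | inj₂ t∈U = proj₂ (proj₂ component _ _ t∈U) (reach-trans (reach-sym (reach-ends e (∈allEdges e))) p)

  module UnCobalancedForest (L : Subset m → Bool) (L-bonds : ∀ B → L B ≡ true → IsBond G B)
    (F B₀ : Subset m) (forest : IsForest G F) (B₀-bond : IsBond G B₀)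
    (B₀-ext : ∀ e → e ∈ B₀ → InExt G F e) (B₀∉L : L B₀ ≡ false) where

    X₀′ = proj₁ (proj₁ B₀-bond)
    B₀≡δX₀′ : B₀ ≡ δ G X₀′
    B₀≡δX₀′ = proj₂ (proj₁ B₀-bond)
    e* = proj₁ (proj₁ (proj₂ B₀-bond))
    e*∈B₀ : e* ∈ B₀
    e*∈B₀ = proj₂ (proj₁ (proj₂ B₀-bond))
    B₀-minimal : ∀ C → IsCut G C → Nonempty C → C ⊆ B₀ → C ≡ B₀
    B₀-minimal = proj₂ (proj₂ B₀-bond)

    F⊆∁B₀ : F ⊆ ∁ B₀
    F⊆∁B₀ {e} e∈F = x∉p⇒x∈∁p (λ e∈B₀ → B₀-ext e e∈B₀ (reach-ends e e∈F))

    private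
      spanning = spanning-forest (∁ B₀) F F⊆∁B₀ forest
    T = proj₁ spanning
    F⊆T : F ⊆ T
    F⊆T = proj₁ (proj₂ spanning)
    T⊆∁B₀ : T ⊆ ∁ B₀
    T⊆∁B₀ = proj₁ (proj₂ (proj₂ spanning))
    T-bridges : AllBridges T
    T-bridges = proj₁ (proj₂ (proj₂ (proj₂ spanning)))
    T-spans : ∀ e → e ∈ ∁ B₀ → src e ~[ T ] tgt e
    T-spans = proj₂ (proj₂ (proj₂ (proj₂ spanning)))

    T∌B₀ : ∀ {e} → e ∈ T → e ∉ B₀
    T∌B₀ e∈T = x∈∁p⇒x∉p (T⊆∁B₀ e∈T)

    T-walk : ∀ {u v} → u ~[ ∁ B₀ ] v → u ~[ T ] v
    T-walk here = here
    T-walk (step e h j p) = reach-trans (reach-joins (T-spans e h) j) (T-walk p)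

    first-B₀-edge : ∀ {u v} → u ~[ allEdges G ] v →
      u ~[ ∁ B₀ ] v ⊎ ∃[ e ] (e ∈ B₀ × (u ~[ ∁ B₀ ] src e ⊎ u ~[ ∁ B₀ ] tgt e))
    first-B₀-edge here = inj₁ here
    first-B₀-edge (step f _ j p) with f ∈? B₀
    ... | yes f∈B₀ = inj₂ (f , f∈B₀ , at-end j)
      where
      at-end : ∀ {u v} → Joins G f u v → u ~[ ∁ B₀ ] src f ⊎ u ~[ ∁ B₀ ] tgt f
      at-end (inj₁ (refl , _)) = inj₁ here
      at-end (inj₂ (_ , refl)) = inj₂ here
    ... | no f∉B₀ with first-B₀-edge p
    ...   | inj₁ q = inj₁ (step f (x∉p⇒x∈∁p f∉B₀) j q)
    ...   | inj₂ (e , e∈B₀ , inj₁ q) = inj₂ (e , e∈B₀ , inj₁ (step f (x∉p⇒x∈∁p f∉B₀) j q))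
    ...   | inj₂ (e , e∈B₀ , inj₂ q) = inj₂ (e , e∈B₀ , inj₂ (step f (x∉p⇒x∈∁p f∉B₀) j q))

    -- Since B₀ is a bond, each of its sides is connected in G − B₀ within a component of G.
    module BondSides (X : Subset n) (B₀≡δX : B₀ ≡ δ G X) where
      ∈δX : ∀ {e} → e ∈ B₀ → e ∈ δ G X
      ∈δX {e} = subst (e ∈_) B₀≡δX

      ∈B₀ : ∀ {e} → e ∈ δ G X → e ∈ B₀
      ∈B₀ {e} = subst (e ∈_) (sym B₀≡δX)

      sideX : ∀ {u v} → u ~[ ∁ B₀ ] v → lookup X u ≡ lookup X v
      sideX = side-preserved X (λ e e∈∁B₀ e∈δX → x∈∁p⇒x∉p e∈∁B₀ (∈B₀ e∈δX))

      -- The component Z of c in G − B₀ has δZ = B₀ = δX, so Z and X differ by a union of components of G.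
      near-bond-edge : ∀ e c c′ → e ∈ B₀ → Joins G e c c′ → ∀ u → c ~[ allEdges G ] u →
                       lookup X u ≡ lookup X c → c ~[ ∁ B₀ ] u
      near-bond-edge e c c′ e∈B₀ j u p same = reachable⇒reach Z-u
        where
        Z = reachable (∁ B₀) c
        δZ⊆B₀ : δ G Z ⊆ B₀
        δZ⊆B₀ {f} f∈δZ with f ∈? B₀
        ... | yes f∈B₀ = f∈B₀
        ... | no f∉B₀ = ⊥-elim (reachable-closed c f (x∉p⇒x∈∁p f∉B₀) f∈δZ)
        Z-c : lookup Z c ≡ true
        Z-c = reach⇒reachable here
        Z-c′ : lookup Z c′ ≡ false
        Z-c′ = unreach⇒unreachable (λ q → crosses-joins X (∈δX e∈B₀) j (sideX q))
        e∈δZ : e ∈ δ G Z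
        e∈δZ = crossing-joins⇒∈δ Z e j (λ q → true≢false (trans (sym Z-c) (trans q Z-c′)))
        δZ≡δX : δ G Z ≡ δ G X
        δZ≡δX = trans (B₀-minimal (δ G Z) (Z , refl) (e , e∈δZ) δZ⊆B₀) B₀≡δX
        difference : ∀ f → f ∈ allEdges G → lookup Z (src f) xor lookup X (src f) ≡ lookup Z (tgt f) xor lookup X (tgt f)
        difference f _ = xor-swap (lookup Z (src f)) (lookup Z (tgt f)) (lookup X (src f)) (lookup X (tgt f))
          (trans (sym (lookup-δ Z f)) (trans (cong (λ V → lookup V f) δZ≡δX) (lookup-δ X f)))
        Z-u : lookup Z u ≡ true
        Z-u = xor-cancel (lookup Z u) (lookup X u)
          (trans (sym (reach-invariant _ difference p)) (cong (_xor lookup X c) Z-c)) same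

      same-side-joined : ∀ {u v} → u ~[ allEdges G ] v → lookup X u ≡ lookup X v → u ~[ ∁ B₀ ] v
      same-side-joined p same with first-B₀-edge p
      ... | inj₁ q = q
      ... | inj₂ (e , e∈B₀ , inj₁ q) =
        reach-trans q (near-bond-edge e (src e) (tgt e) e∈B₀ (joins-ends e) _
          (reach-trans (reach-sym (reach-mono ⊆allEdges q)) p) (trans (sym same) (sideX q)))
      ... | inj₂ (e , e∈B₀ , inj₂ q) =
        reach-trans q (near-bond-edge e (tgt e) (src e) e∈B₀ (joins-sym (joins-ends e)) _
          (reach-trans (reach-sym (reach-mono ⊆allEdges q)) p) (trans (sym same) (sideX q)))

    open BondSides X₀′ B₀≡δX₀′ using () renaming (sideX to sideX₀′; same-side-joined to same-side-joined₀′; ∈δX to ∈δX₀′; ∈B₀ to ∈B₀′)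

    B₀-connected : ∀ e → e ∈ B₀ → src e* ~[ allEdges G ] src e
    B₀-connected e e∈B₀ = reachable⇒reach Z-src
      where
      Z = reachable (allEdges G) (src e*)
      Y : Subset n
      Y = tabulate (λ v → lookup X₀′ v ∧ lookup Z v)
      lookup-Y : ∀ v → lookup Y v ≡ lookup X₀′ v ∧ lookup Z v
      lookup-Y v = lookup∘tabulate _ v
      Z-same : ∀ f → lookup Z (src f) ≡ lookup Z (tgt f)
      Z-same f = same-side Z (reachable-closed (src e*) f (∈allEdges f))
      in-Z : ∀ f → lookup Z (src f) ≡ true → lookup (δ G Y) f ≡ lookup (δ G X₀′) f
      in-Z f z = trans (lookup-δ Y f) (trans (cong₂ _xor_
                   (trans (lookup-Y _) (trans (cong (lookup X₀′ (src f) ∧_) z) (∧-identityʳ _)))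
                   (trans (lookup-Y _) (trans (cong (lookup X₀′ (tgt f) ∧_) (trans (sym (Z-same f)) z)) (∧-identityʳ _))))
                   (sym (lookup-δ X₀′ f)))
      off-Z : ∀ f → lookup Z (src f) ≡ false → f ∉ δ G Y
      off-Z f z = same-side⇒∉δ Y f (trans (lookup-Y _) (trans (cong (lookup X₀′ (src f) ∧_) z) (trans (∧-zeroʳ _)
                    (sym (trans (lookup-Y _) (trans (cong (lookup X₀′ (tgt f) ∧_) (trans (sym (Z-same f)) z)) (∧-zeroʳ _)))))))
      δY⊆B₀ : δ G Y ⊆ B₀
      δY⊆B₀ {f} f∈δY with lookup Z (src f) in z
      ... | true = ∈B₀′ (lookup≡true⇒∈ (trans (sym (in-Z f z)) (∈⇒lookup≡true f∈δY)))
      ... | false = ⊥-elim (off-Z f z f∈δY)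
      e*∈δY : e* ∈ δ G Y
      e*∈δY = lookup≡true⇒∈ (trans (in-Z e* (reach⇒reachable here)) (∈⇒lookup≡true (∈δX₀′ e*∈B₀)))
      δY≡B₀ : δ G Y ≡ B₀
      δY≡B₀ = B₀-minimal (δ G Y) (Y , refl) (e* , e*∈δY) δY⊆B₀
      Z-src : lookup Z (src e) ≡ true
      Z-src with lookup Z (src e) in z
      ... | true = refl
      ... | false = ⊥-elim (off-Z e z (subst (e ∈_) (sym δY≡B₀) e∈B₀))

    crossing-walk-meets-e* : ∀ u v → u ~[ allEdges G ] v → lookup X₀′ u ≢ lookup X₀′ v → src e* ~[ allEdges G ] u
    crossing-walk-meets-e* u v p differ with first-B₀-edge p
    ... | inj₁ q = ⊥-elim (differ (sideX₀′ q))
    ... | inj₂ (e , e∈B₀ , inj₁ q) = reach-trans (B₀-connected e e∈B₀) (reach-sym (reach-mono ⊆allEdges q))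
    ... | inj₂ (e , e∈B₀ , inj₂ q) =
      reach-trans (B₀-connected e e∈B₀) (reach-trans (reach-ends e (∈allEdges e)) (reach-sym (reach-mono ⊆allEdges q)))

    components-minus-B₀ : ∀ {k} → HasComponents G (allEdges G) k → HasComponents G (∁ B₀) (suc k)
    components-minus-B₀ c = components-split X₀′ e* c ⊆allEdges
      (λ e e∈∁B₀ e∈δ → x∈∁p⇒x∉p e∈∁B₀ (∈B₀′ e∈δ)) (λ u v p same → same-side-joined₀′ p same)
      (∈allEdges e*) (∈δX₀′ e*∈B₀) crossing-walk-meets-e*

    B₀-not-modular-with-itself : ¬ IsModularPair G B₀ B₀
    B₀-not-modular-with-itself (_ , _ , k , c , c₂) with components-unique (∁ B₀) (components-minus-B₀ c) c₂′
      where
      c₂′ : HasComponents G (∁ B₀) (2 + k)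
      c₂′ = components-resp (λ h → x∉p⇒x∈∁p (λ e∈B₀ → x∈∁p⇒x∉p h (x∈p∪q⁺ (inj₁ e∈B₀))))
                            (λ h → x∉p⇒x∈∁p (λ e∈ → [ x∈∁p⇒x∉p h , x∈∁p⇒x∉p h ]′ (x∈p∪q⁻ B₀ B₀ e∈))) c₂
    ... | ()

    dualBasis : Subset (suc m)
    dualBasis = outside ∷ ∁ T

    dualBasis-disjoint : Disjoint G dualBasis (inside ∷ F)
    dualBasis-disjoint zero () _
    dualBasis-disjoint (suc e) e∈∁T e∈F = x∈∁p⇒x∉p (drop-there e∈∁T) (F⊆T (drop-there e∈F))

    cut-avoiding-T : ∀ Y → (∀ t → t ∈ T → t ∉ δ G Y) → Nonempty (δ G Y) → δ G Y ≡ B₀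
    cut-avoiding-T Y avoids nonempty = B₀-minimal (δ G Y) (Y , refl) nonempty δY⊆B₀
      where
      δY⊆B₀ : δ G Y ⊆ B₀
      δY⊆B₀ {e} e∈δY with e ∈? B₀
      ... | yes e∈B₀ = e∈B₀
      ... | no e∉B₀ = ⊥-elim (spanned-edge-meets-cut T Y (T-spans e (x∉p⇒x∈∁p e∉B₀)) e∈δY avoids)

    dualBasis-free : CocircuitFree G L dualBasis
    dualBasis-free D D-coc D⊆ = go D-coc
      where
      cut-in-D : ∀ Y → (∀ {e} → e ∈ δ G Y → suc e ∈ D) → Nonempty (δ G Y) → δ G Y ≡ B₀
      cut-in-D Y δY⊆D = cut-avoiding-T Y (λ t t∈T t∈δY → x∈∁p⇒x∉p (drop-there (D⊆ (δY⊆D t∈δY))) t∈T)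
      go : J₀Cocircuit G L D → ⊥
      go (inj₁ (_ , ((Y , refl) , nonempty , _) , Y∈L , refl)) =
        true≢false (trans (sym Y∈L) (trans (cong L (cut-in-D Y there nonempty)) B₀∉L))
      go (inj₂ (inj₁ (_ , _ , _ , refl))) with D⊆ here
      ... | ()
      go (inj₂ (inj₂ (_ , inj₁ (X₁ , X₂ , X₃ , (_ , d₁₂ , d₁₃ , d₂₃ , _ , _ , _ ,
                                              (e , u , v , u∈ , v∈ , j) , (e′ , u′ , v′ , u′∈ , v′∈ , j′) , _) , refl) , _ , refl))) =
        -- δX₁ = B₀ = δX₂, but an X₁–X₃ edge lies in δX₁ and not in δX₂
        same-side⇒∉δ X₂ e′ X₂-same (subst (e′ ∈_) (trans δX₁≡B₀ (sym δX₂≡B₀)) (edge-between⇒∈δ d₁₃ u′∈ v′∈ j′))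
        where
        δX₁≡B₀ = cut-in-D X₁ (λ h → there (x∈p∪q⁺ (inj₁ h))) (e , edge-between⇒∈δ d₁₂ u∈ v∈ j)
        δX₂≡B₀ = cut-in-D X₂ (λ h → there (x∈p∪q⁺ (inj₂ (x∈p∪q⁺ (inj₁ h))))) (e , edge-between⇒∈δ′ d₁₂ u∈ v∈ j)
        u′∉X₂ = ∉⇒lookup≡false (d₁₂ u′ u′∈)
        v′∉X₂ = ∉⇒lookup≡false (λ h → d₂₃ v′ h v′∈)
        X₂-same : lookup X₂ (src e′) ≡ lookup X₂ (tgt e′)
        X₂-same = [ (λ { (refl , refl) → trans u′∉X₂ (sym v′∉X₂) }) , (λ { (refl , refl) → trans v′∉X₂ (sym u′∉X₂) }) ]′ j′
      go (inj₂ (inj₂ (_ , inj₂ (_ , _ , ((modular@(((Y₁ , refl) , nonempty₁ , _) , ((Y₂ , refl) , nonempty₂ , _) , _)) , refl) , _) ,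
                           _ , refl))) =
        B₀-not-modular-with-itself (subst₂ (IsModularPair G) δY₁≡B₀ δY₂≡B₀ modular)
        where
        δY₁≡B₀ = cut-in-D Y₁ (λ h → there (x∈p∪q⁺ (inj₁ h))) nonempty₁
        δY₂≡B₀ = cut-in-D Y₂ (λ h → there (x∈p∪q⁺ (inj₂ h))) nonempty₂

    FundamentalCocircuit : Fin m → Set
    FundamentalCocircuit t = ∃[ D ] (J₀Cocircuit G L D × D ⊆ ⁅ suc t ⁆ ∪ dualBasis)

    MeetsB₀ : Subset n → Set
    MeetsB₀ X = ∃[ e ] (e ∈ B₀ × (lookup X (src e) ≡ true ⊎ lookup X (tgt e) ≡ true))

    meets-B₀? : ∀ X → Dec (MeetsB₀ X)
    meets-B₀? X = any? (λ e → (e ∈? B₀) ×-dec ((lookup X (src e) ≟ᵇ true) ⊎-dec (lookup X (tgt e) ≟ᵇ true)))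

    misses-B₀ : ∀ X → ¬ MeetsB₀ X → ∀ e → e ∈ B₀ → ∀ v → v ≡ src e ⊎ v ≡ tgt e → lookup X v ≡ false
    misses-B₀ X misses e e∈B₀ v v-end with lookup X v in q
    ... | false = refl
    ... | true = ⊥-elim (misses (e , e∈B₀ , Sum.map (λ { refl → q }) (λ { refl → q }) v-end))

    meets-via-edge : ∀ X e {u v} → e ∈ B₀ → Joins G e u v → lookup X u ≡ true → MeetsB₀ X
    meets-via-edge X e e∈B₀ (inj₁ (refl , _)) h = e , e∈B₀ , inj₁ h
    meets-via-edge X e e∈B₀ (inj₂ (_ , refl)) h = e , e∈B₀ , inj₂ h

    oriented-end : ∀ X e → lookup X (src e) ≡ true ⊎ lookup X (tgt e) ≡ true →
                   ∃[ u ] ∃[ v ] (Joins G e u v × lookup X u ≡ true)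
    oriented-end X e (inj₁ h) = src e , tgt e , joins-ends e , h
    oriented-end X e (inj₂ h) = tgt e , src e , joins-sym (joins-ends e) , h

    -- Every edge t of T lies in a cocircuit of J₀ avoiding e₀ and the rest of T. Let P, Q be the
    -- sides of t in T − t. If one of them, say C, misses B₀, the cocircuit is δC or the dibond
    -- δC ∪ B₀; if both meet B₀, it is δP, δQ, or the tribond of P, Q and the class beyond B₀.
    module Fundamental (t : Fin m) (t∈T : t ∈ T) where
      a = src t
      b = tgt t
      module Cut-a = FundamentalCut T t t∈T T-bridges a b (inj₁ (refl , refl))
      module Cut-b = FundamentalCut T t t∈T T-bridges b a (inj₂ (refl , refl))
      N = Cut-a.N
      P = Cut-a.P
      Q = Cut-b.P

      t∈∁B₀ : t ∈ ∁ B₀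
      t∈∁B₀ = T⊆∁B₀ t∈T

      N⊆∁B₀ : N ⊆ ∁ B₀
      N⊆∁B₀ h = T⊆∁B₀ (Cut-a.N⊆T h)

      oriented : ∃[ X ] (B₀ ≡ δ G X × lookup X a ≡ true)
      oriented with lookup X₀′ a in q
      ... | true = X₀′ , B₀≡δX₀′ , q
      ... | false = ∁ X₀′ , trans B₀≡δX₀′ (sym (δ-∁ X₀′)) , trans (lookup-map a not X₀′) (cong not q)
      X₀ = proj₁ oriented
      B₀≡δX₀ : B₀ ≡ δ G X₀
      B₀≡δX₀ = proj₁ (proj₂ oriented)
      X₀-a : lookup X₀ a ≡ true
      X₀-a = proj₂ (proj₂ oriented)
      open BondSides X₀ B₀≡δX₀

      sideN : ∀ {u v} → u ~[ N ] v → lookup X₀ u ≡ lookup X₀ v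
      sideN p = sideX (reach-mono N⊆∁B₀ p)

      a~b : a ~[ ∁ B₀ ] b
      a~b = reach-ends t t∈∁B₀

      X₀-b : lookup X₀ b ≡ true
      X₀-b = trans (sym (sideX a~b)) X₀-a

      B₀-crosses-X₀ : ∀ e → e ∈ B₀ → lookup X₀ (src e) ≢ lookup X₀ (tgt e)
      B₀-crosses-X₀ e e∈B₀ = crosses X₀ (∈δX e∈B₀)

      near-a : ∀ {v} → a ~[ ∁ B₀ ] v → a ~[ N ] v ⊎ b ~[ N ] v
      near-a p with reach⇒via-edge t Cut-a.∈N (T-walk p)
      ... | inj₁ q = inj₁ q
      ... | inj₂ (_ , q) = Cut-a.from-ends q

      away-from-a : ∀ {u v} → u ~[ ∁ B₀ ] v → ¬ (u ~[ ∁ B₀ ] a) → u ~[ N ] v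
      away-from-a p u≁a with reach⇒via-edge t Cut-a.∈N (T-walk p)
      ... | inj₁ q = q
      ... | inj₂ (inj₁ q , _) = ⊥-elim (u≁a (reach-mono N⊆∁B₀ q))
      ... | inj₂ (inj₂ q , _) = ⊥-elim (u≁a (reach-trans (reach-mono N⊆∁B₀ q) (reach-sym a~b)))

      outside-X₀ : ∀ {u v} → u ~[ ∁ B₀ ] v → lookup X₀ u ≡ false → u ~[ N ] v
      outside-X₀ p u∉X₀ = away-from-a p (λ q → true≢false (trans (sym X₀-a) (trans (sym (sideX q)) u∉X₀)))

      -- The cocircuit δC, or the dibond δC ∪ B₀ when δC is not cobalanced.
      module Dibond (p q : Fin n) (t-pq : (src t ≡ p × tgt t ≡ q) ⊎ (src t ≡ q × tgt t ≡ p))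
                    (C-misses : ¬ MeetsB₀ (reachable N p)) where
        module Cut-p = FundamentalCut T t t∈T T-bridges p q t-pq
        C = Cut-p.P
        D = δ G C ∪ B₀

        δC-misses-B₀ : ∀ e → e ∈ δ G C → e ∉ B₀
        δC-misses-B₀ e e∈δC e∈B₀ = C-misses (e , e∈B₀ , ∈δ⇒end-inside C e e∈δC)

        δC-bond : IsBond G (δ G C)
        δC-bond = Cut-p.δP-bond (λ e e∈δC → T-spans e (x∉p⇒x∈∁p (δC-misses-B₀ e e∈δC)))

        N-avoids-D : ∀ e → e ∈ N → e ∉ D
        N-avoids-D e e∈N e∈D = [ Cut-p.N∉δP e e∈N , x∈∁p⇒x∉p (N⊆∁B₀ e∈N) ]′ (x∈p∪q⁻ (δ G C) B₀ e∈D)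

        C-separates : lookup C p ≢ lookup C q
        C-separates eq = true≢false (trans (sym Cut-p.P-a) (trans eq Cut-p.P-b))

        X₀-p≡q : lookup X₀ p ≡ lookup X₀ q
        X₀-p≡q = [ (λ { (refl , refl) → sideX a~b }) , (λ { (refl , refl) → sym (sideX a~b) }) ]′ t-pq

        δC-B₀-modular : IsModularPair G (δ G C) B₀
        δC-B₀-modular = δC-bond , B₀-bond , k , c , components-split C t (components-minus-B₀ c)
            ∁D⊆∁B₀ ∁D-avoids-δC same-side-joined′ t∈∁B₀ Cut-p.t∈δP crossing-at-t
          where
          k = proj₁ (components-exist (allEdges G))
          c = proj₂ (components-exist (allEdges G))
          ∁D⊆∁B₀ : ∁ D ⊆ ∁ B₀
          ∁D⊆∁B₀ h = x∉p⇒x∈∁p (λ e∈B₀ → x∈∁p⇒x∉p h (x∈p∪q⁺ (inj₂ e∈B₀)))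
          ∁D-avoids-δC : ∀ e → e ∈ ∁ D → e ∉ δ G C
          ∁D-avoids-δC e h e∈δC = x∈∁p⇒x∉p h (x∈p∪q⁺ (inj₁ e∈δC))
          N⊆∁D : N ⊆ ∁ D
          N⊆∁D {e} e∈N = x∉p⇒x∈∁p (N-avoids-D e e∈N)
          same-side-joined′ : ∀ u v → u ~[ ∁ B₀ ] v → lookup C u ≡ lookup C v → u ~[ ∁ D ] v
          same-side-joined′ u v w same with reach⇒via-edge t Cut-p.∈N (T-walk w)
          ... | inj₁ r = reach-mono N⊆∁D r
          ... | inj₂ (l , r) with Cut-p.to-ends l | Cut-p.from-ends r
          ...   | inj₁ l′ | inj₁ r′ = reach-mono N⊆∁D (reach-trans l′ r′)
          ...   | inj₂ l′ | inj₂ r′ = reach-mono N⊆∁D (reach-trans l′ r′)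
          ...   | inj₁ l′ | inj₂ r′ = ⊥-elim (C-separates (trans (sym (Cut-p.sideP l′)) (trans same (sym (Cut-p.sideP r′)))))
          ...   | inj₂ l′ | inj₁ r′ = ⊥-elim (C-separates (trans (Cut-p.sideP r′) (trans (sym same) (Cut-p.sideP l′))))
          crossing-at-t : ∀ u v → u ~[ ∁ B₀ ] v → lookup C u ≢ lookup C v → src t ~[ ∁ B₀ ] u
          crossing-at-t u v w differ with reach⇒via-edge t Cut-p.∈N (T-walk w)
          ... | inj₁ r = ⊥-elim (differ (Cut-p.sideP r))
          ... | inj₂ (inj₁ l , _) = reach-sym (reach-mono N⊆∁B₀ l)
          ... | inj₂ (inj₂ l , _) = reach-trans a~b (reach-sym (reach-mono N⊆∁B₀ l))

        D⊆ : (outside ∷ D) ⊆ ⁅ suc t ⁆ ∪ dualBasis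
        D⊆ = ⊆-edge∪∁ t D T (λ ()) λ e e∈D e∈T →
          [ (λ e∈δC → Cut-p.δP∩T e e∈δC e∈T) , (λ e∈B₀ → ⊥-elim (T∌B₀ e∈T e∈B₀)) ]′ (x∈p∪q⁻ (δ G C) B₀ e∈D)

        δC⊆ : (outside ∷ δ G C) ⊆ ⁅ suc t ⁆ ∪ dualBasis
        δC⊆ = ⊆-edge∪∁ t (δ G C) T (λ ()) Cut-p.δP∩T

        -- A cut inside D has a signature in Bool²: (true, false) is δC, (false, true) is B₀, and
        -- (true, true) would be a bond containing δC, hence equal to δC, which misses e*.
        module NoCobalancedBond (w₁ w₂ : Fin n) (C-w : lookup C w₁ ≡ lookup C w₂) (X₀-w : lookup X₀ w₁ ≢ lookup X₀ w₂)
          (anchored : ∀ e → e ∈ D → ∃[ i ] ((pair p w₁ i ~[ N ] src e × pair q w₂ i ~[ N ] tgt e) ⊎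
                                             (pair q w₂ i ~[ N ] src e × pair p w₁ i ~[ N ] tgt e))) where
          open CutSignatures D N (pair p w₁) (pair q w₂) N-avoids-D anchored

          no-L-bond : L (δ G C) ≡ false → ContainsNoBondOf G L D
          no-L-bond δC∉L _ ((Y , refl) , nonempty , Y-minimal) Y∈L δY⊆D
            with signature Y zero in s₀ | signature Y (suc zero) in s₁
          ... | true | false =
            true≢false (trans (sym Y∈L) (trans (cong L (δ-≡-by-signature Y C δY⊆D (λ h → x∈p∪q⁺ (inj₁ h)) same)) δC∉L))
            where
            same : ∀ i → signature Y i ≡ signature C i
            same zero = trans s₀ (sym (≢⇒xor≡true C-separates))
            same (suc zero) = trans s₁ (sym (≡⇒xor≡false C-w))
          ... | false | true =
            true≢false (trans (sym Y∈L) (trans (cong L (trans (δ-≡-by-signature Y X₀ δY⊆D δX₀⊆D same) (sym B₀≡δX₀))) B₀∉L))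
            where
            δX₀⊆D : δ G X₀ ⊆ D
            δX₀⊆D h = x∈p∪q⁺ (inj₂ (∈B₀ h))
            same : ∀ i → signature Y i ≡ signature X₀ i
            same zero = trans s₀ (sym (≡⇒xor≡false X₀-p≡q))
            same (suc zero) = trans s₁ (sym (≢⇒xor≡true X₀-w))
          ... | false | false = signature-false⇒empty Y δY⊆D (λ { zero → s₀ ; (suc zero) → s₁ }) nonempty
          ... | true | true = δC-misses-B₀ e* (subst (e* ∈_) (sym δC≡δY) (D⊆δY (x∈p∪q⁺ (inj₂ e*∈B₀)))) e*∈B₀
            where
            D⊆δY : D ⊆ δ G Y
            D⊆δY = signature-true⇒⊇ Y δY⊆D (λ { zero → s₀ ; (suc zero) → s₁ })
            δC≡δY : δ G C ≡ δ G Y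
            δC≡δY = Y-minimal (δ G C) (C , refl) (t , Cut-p.t∈δP) (λ h → D⊆δY (x∈p∪q⁺ (inj₁ h)))

        cocircuit : (L (δ G C) ≡ false → ¬ IsTribond G D) → (L (δ G C) ≡ false → ContainsNoBondOf G L D) →
                    FundamentalCocircuit t
        cocircuit not-tribond no-bond with L (δ G C) in δC∈?L
        ... | true = (outside ∷ δ G C) , inj₁ (δ G C , δC-bond , δC∈?L , refl) , δC⊆
        ... | false = (outside ∷ D) , inj₂ (inj₂ (D , inj₂ (δ G C , B₀ , (δC-B₀-modular , refl) , not-tribond refl) ,
                                                  no-bond refl , refl)) , D⊆

      -- Neither side of t meets B₀: then t and B₀ lie in different components of G.
      module NeitherMeets (P-misses : ¬ MeetsB₀ P) (Q-misses : ¬ MeetsB₀ Q) where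
        c = src e*
        c′ = tgt e*

        B₀-far-from-a : ∀ e → e ∈ B₀ → ∀ v → v ≡ src e ⊎ v ≡ tgt e → ¬ (a ~[ ∁ B₀ ] v)
        B₀-far-from-a e e∈B₀ v v-end r with near-a r
        ... | inj₁ r′ = true≢false (trans (sym (reach⇒reachable r′)) (misses-B₀ P P-misses e e∈B₀ v v-end))
        ... | inj₂ r′ = true≢false (trans (sym (reach⇒reachable r′)) (misses-B₀ Q Q-misses e e∈B₀ v v-end))

        a≁c : ¬ (a ~[ allEdges G ] c)
        a≁c p with first-B₀-edge p
        ... | inj₁ q = B₀-far-from-a e* e*∈B₀ c (inj₁ refl) q
        ... | inj₂ (e , e∈B₀ , inj₁ q) = B₀-far-from-a e e∈B₀ _ (inj₁ refl) q
        ... | inj₂ (e , e∈B₀ , inj₂ q) = B₀-far-from-a e e∈B₀ _ (inj₂ refl) q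

        module Dib = Dibond a b (inj₁ (refl , refl)) P-misses

        not-tribond : ¬ IsTribond G Dib.D
        not-tribond (X₁ , X₂ , X₃ , tp , D≡Tr) = a≁c (proj₁ (proj₂ (proj₁ tp) a c a∈U) c∈U)
          where
          open TripartitionFacts X₁ X₂ X₃ tp
          a∈U = Tr-edge-reaches-U t (subst (t ∈_) D≡Tr (x∈p∪q⁺ (inj₁ Dib.Cut-p.t∈δP))) here
          c∈U = Tr-edge-reaches-U e* (subst (e* ∈_) D≡Tr (x∈p∪q⁺ (inj₂ e*∈B₀))) here

        anchor-at-e* : ∀ v → c ~[ allEdges G ] v → c ~[ N ] v ⊎ c′ ~[ N ] v
        anchor-at-e* v p with bool-either {z = lookup X₀ v} (B₀-crosses-X₀ e* e*∈B₀)
        ... | inj₁ same = inj₁ (away-from-a (same-side-joined p (sym same))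
                                            (λ r → B₀-far-from-a e* e*∈B₀ c (inj₁ refl) (reach-sym r)))
        ... | inj₂ same = inj₂ (away-from-a (same-side-joined (reach-trans (reach-sym (reach-ends e* (∈allEdges e*))) p) (sym same))
                                            (λ r → B₀-far-from-a e* e*∈B₀ c′ (inj₂ refl) (reach-sym r)))

        anchored : ∀ e → e ∈ Dib.D → ∃[ i ] ((pair a c i ~[ N ] src e × pair b c′ i ~[ N ] tgt e) ⊎
                                              (pair b c′ i ~[ N ] src e × pair a c i ~[ N ] tgt e))
        anchored e e∈D with x∈p∪q⁻ (δ G P) B₀ e∈D
        ... | inj₁ e∈δP = zero , Cut-a.δP-two-sided e e∈δP (T-spans e (x∉p⇒x∈∁p (Dib.δC-misses-B₀ e e∈δP)))
        ... | inj₂ e∈B₀ with anchor-at-e* (src e) (B₀-connected e e∈B₀)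
                           | anchor-at-e* (tgt e) (reach-trans (B₀-connected e e∈B₀) (reach-ends e (∈allEdges e)))
        ...   | inj₁ r₁ | inj₂ r₂ = suc zero , inj₁ (r₁ , r₂)
        ...   | inj₂ r₁ | inj₁ r₂ = suc zero , inj₂ (r₁ , r₂)
        ...   | inj₁ r₁ | inj₁ r₂ = ⊥-elim (B₀-crosses-X₀ e e∈B₀ (trans (sym (sideN r₁)) (sideN r₂)))
        ...   | inj₂ r₁ | inj₂ r₂ = ⊥-elim (B₀-crosses-X₀ e e∈B₀ (trans (sym (sideN r₁)) (sideN r₂)))

        P-c≡c′ : lookup P c ≡ lookup P c′
        P-c≡c′ = trans (misses-B₀ P P-misses e* e*∈B₀ c (inj₁ refl)) (sym (misses-B₀ P P-misses e* e*∈B₀ c′ (inj₂ refl)))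

        open Dib.NoCobalancedBond c c′ P-c≡c′ (B₀-crosses-X₀ e* e*∈B₀) anchored

        cocircuit : FundamentalCocircuit t
        cocircuit = Dib.cocircuit (λ _ → not-tribond) no-L-bond

      -- Only the side of x meets B₀, through the edge f from x′ to z; the side of y does not.
      module OneMeets (x y : Fin n) (t-yx : (src t ≡ y × tgt t ≡ x) ⊎ (src t ≡ x × tgt t ≡ y))
                      (X₀-x : lookup X₀ x ≡ true) (X₀-y : lookup X₀ y ≡ true)
                      (f : Fin m) (x′ z : Fin n) (f-x′z : Joins G f x′ z) (f∈B₀ : f ∈ B₀)
                      (x′-near-x : lookup (reachable N x) x′ ≡ true)
                      (y-misses : ¬ MeetsB₀ (reachable N y)) where
        module Dib = Dibond y x t-yx y-misses
        C = Dib.C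

        x~x′ : x ~[ N ] x′
        x~x′ = reachable⇒reach x′-near-x

        X₀-z : lookup X₀ z ≡ false
        X₀-z with lookup X₀ z in q
        ... | false = refl
        ... | true = ⊥-elim (crosses-joins X₀ (∈δX f∈B₀) f-x′z (trans (trans (sym (sideN x~x′)) X₀-x) (sym q)))

        x~z : x ~[ allEdges G ] z
        x~z = reach-trans (reach-mono ⊆allEdges x~x′) (reach-edge (∈allEdges f) f-x′z)

        x~e* : x ~[ allEdges G ] src e*
        x~e* = reach-trans (reach-mono ⊆allEdges x~x′)
                 (reach-trans (reach-sym (src-reaches-end f-x′z)) (reach-sym (B₀-connected f f∈B₀)))

        near-x : ∀ {v} → x ~[ ∁ B₀ ] v → x ~[ N ] v ⊎ y ~[ N ] v
        near-x p with reach⇒via-edge t Dib.Cut-p.∈N (T-walk p)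
        ... | inj₁ q = inj₁ q
        ... | inj₂ (_ , r) = Sum.swap (Dib.Cut-p.from-ends r)

        t~y : src t ~[ allEdges G ] y
        t~y = [ (λ { (refl , _) → here }) , (λ { (_ , refl) → reach-ends t (∈allEdges t) }) ]′ t-yx

        t~x : src t ~[ allEdges G ] x
        t~x = [ (λ { (_ , refl) → reach-ends t (∈allEdges t) }) , (λ { (refl , _) → here }) ]′ t-yx

        -- In a tripartition with Tr = D, the X₀-sides of y and z force a B₀-edge leaving C.
        not-tribond : ¬ IsTribond G Dib.D
        not-tribond (X₁ , X₂ , X₃ , tp , D≡Tr) = refute (U-linked y∈U z∈U)
          where
          open TripartitionFacts X₁ X₂ X₃ tp
          t∈Tr = subst (t ∈_) D≡Tr (x∈p∪q⁺ (inj₁ Dib.Cut-p.t∈δP))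
          y∈U = Tr-edge-reaches-U t t∈Tr t~y
          z∈U = Tr-edge-reaches-U t t∈Tr (reach-trans t~x x~z)
          side-off-D : ∀ Z → δ G Z ⊆ Dib.D → ∀ {u v} → u ~[ ∁ Tr ] v → lookup Z u ≡ lookup Z v
          side-off-D Z δZ⊆D = side-preserved Z (λ f f∈ f∈δZ → x∈∁p⇒x∉p f∈ (subst (f ∈_) D≡Tr (δZ⊆D f∈δZ)))
          sideX₀ : ∀ {u v} → u ~[ ∁ Tr ] v → lookup X₀ u ≡ lookup X₀ v
          sideX₀ = side-off-D X₀ (λ h → x∈p∪q⁺ (inj₂ (∈B₀ h)))
          refute : y ~[ ∁ Tr ] z ⊎ ∃[ e ] ∃[ u ] ∃[ v ] (Joins G e u v × y ~[ ∁ Tr ] u × v ~[ ∁ Tr ] z) → ⊥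
          refute (inj₁ r) = true≢false (trans (sym X₀-y) (trans (sideX₀ r) X₀-z))
          refute (inj₂ (e , u , v , j , r₁ , r₂)) = y-misses (meets-via-edge C e e∈B₀ j C-u)
            where
            X₀-u : lookup X₀ u ≡ true
            X₀-u = trans (sym (sideX₀ r₁)) X₀-y
            X₀-v : lookup X₀ v ≡ false
            X₀-v = trans (sideX₀ r₂) X₀-z
            e∈B₀ : e ∈ B₀
            e∈B₀ = ∈B₀ (crossing-joins⇒∈δ X₀ e j (λ q → true≢false (trans (sym X₀-u) (trans q X₀-v))))
            C-u : lookup C u ≡ true
            C-u = trans (sym (side-off-D C (λ h → x∈p∪q⁺ (inj₁ h)) r₁)) Dib.Cut-p.P-a

        anchor-B₀-end : ∀ e → e ∈ B₀ → ∀ v → x ~[ allEdges G ] v → v ≡ src e ⊎ v ≡ tgt e → x ~[ N ] v ⊎ z ~[ N ] v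
        anchor-B₀-end e e∈B₀ v p v-end with bool-either {z = lookup X₀ v} true≢false
        ... | inj₁ v∈X₀ with near-x (same-side-joined p (trans X₀-x (sym v∈X₀)))
        ...   | inj₁ r = inj₁ r
        ...   | inj₂ r = ⊥-elim (true≢false (trans (sym (reach⇒reachable r)) (misses-B₀ C y-misses e e∈B₀ v v-end)))
        anchor-B₀-end e e∈B₀ v p v-end | inj₂ v∉X₀ =
          inj₂ (outside-X₀ (same-side-joined (reach-trans (reach-sym x~z) p) (trans X₀-z (sym v∉X₀))) X₀-z)

        anchored : ∀ e → e ∈ Dib.D → ∃[ i ] ((pair y x i ~[ N ] src e × pair x z i ~[ N ] tgt e) ⊎
                                              (pair x z i ~[ N ] src e × pair y x i ~[ N ] tgt e))
        anchored e e∈D with x∈p∪q⁻ (δ G C) B₀ e∈D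
        ... | inj₁ e∈δC = zero , Dib.Cut-p.δP-two-sided e e∈δC (T-spans e (x∉p⇒x∈∁p (Dib.δC-misses-B₀ e e∈δC)))
        ... | inj₂ e∈B₀ with anchor-B₀-end e e∈B₀ (src e) (reach-trans x~e* (B₀-connected e e∈B₀)) (inj₁ refl)
                           | anchor-B₀-end e e∈B₀ (tgt e)
                               (reach-trans x~e* (reach-trans (B₀-connected e e∈B₀) (reach-ends e (∈allEdges e)))) (inj₂ refl)
        ...   | inj₁ r₁ | inj₂ r₂ = suc zero , inj₁ (r₁ , r₂)
        ...   | inj₂ r₁ | inj₁ r₂ = suc zero , inj₂ (r₁ , r₂)
        ...   | inj₁ r₁ | inj₁ r₂ = ⊥-elim (B₀-crosses-X₀ e e∈B₀ (trans (sym (sideN r₁)) (sideN r₂)))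
        ...   | inj₂ r₁ | inj₂ r₂ = ⊥-elim (B₀-crosses-X₀ e e∈B₀ (trans (sym (sideN r₁)) (sideN r₂)))

        C-x≡z : lookup C x ≡ lookup C z
        C-x≡z = trans Dib.Cut-p.P-b (sym (unreach⇒unreachable (λ r → true≢false (trans (sym X₀-y) (trans (sideN r) X₀-z)))))

        open Dib.NoCobalancedBond x z C-x≡z (λ q → true≢false (trans (sym X₀-x) (trans q X₀-z))) anchored

        cocircuit : FundamentalCocircuit t
        cocircuit = Dib.cocircuit (λ _ → not-tribond) no-L-bond

      -- Both sides meet B₀: P, Q and the side Y of y (beyond a B₀-edge from P) form a tripartition.
      module BothMeet (f : Fin m) (x′ y : Fin n) (f-x′y : Joins G f x′ y) (f∈B₀ : f ∈ B₀) (x′∈P : lookup P x′ ≡ true)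
                      (g : Fin m) (z′ y′ : Fin n) (g-z′y′ : Joins G g z′ y′) (g∈B₀ : g ∈ B₀) (z′∈Q : lookup Q z′ ≡ true) where
        Y = reachable N y

        a~x′ : a ~[ N ] x′
        a~x′ = reachable⇒reach x′∈P

        b~z′ : b ~[ N ] z′
        b~z′ = reachable⇒reach z′∈Q

        X₀-y : lookup X₀ y ≡ false
        X₀-y with lookup X₀ y in q
        ... | false = refl
        ... | true = ⊥-elim (crosses-joins X₀ (∈δX f∈B₀) f-x′y (trans (trans (sym (sideN a~x′)) X₀-a) (sym q)))

        X₀-y′ : lookup X₀ y′ ≡ false
        X₀-y′ with lookup X₀ y′ in q
        ... | false = refl
        ... | true = ⊥-elim (crosses-joins X₀ (∈δX g∈B₀) g-z′y′ (trans (trans (sym (sideN b~z′)) X₀-b) (sym q)))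

        a~ᴳb : a ~[ allEdges G ] b
        a~ᴳb = reach-ends t (∈allEdges t)

        a~y : a ~[ allEdges G ] y
        a~y = reach-trans (reach-mono ⊆allEdges a~x′) (reach-edge (∈allEdges f) f-x′y)

        a~e* : a ~[ allEdges G ] src e*
        a~e* = reach-trans (reach-mono ⊆allEdges a~x′)
                 (reach-trans (reach-sym (src-reaches-end f-x′y)) (reach-sym (B₀-connected f f∈B₀)))

        classify : ∀ v → a ~[ allEdges G ] v → a ~[ N ] v ⊎ b ~[ N ] v ⊎ y ~[ N ] v
        classify v p with bool-either {z = lookup X₀ v} true≢false
        ... | inj₁ v∈X₀ = Sum.map (λ r → r) inj₁ (near-a (same-side-joined p (trans X₀-a (sym v∈X₀))))
        ... | inj₂ v∉X₀ = inj₂ (inj₂ (outside-X₀ (same-side-joined (reach-trans (reach-sym a~y) p) (trans X₀-y (sym v∉X₀))) X₀-y))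

        not-with-y : ∀ {s v} → lookup X₀ s ≡ true → s ~[ N ] v → ¬ (y ~[ N ] v)
        not-with-y X₀-s r₁ r₂ = true≢false (trans (sym X₀-s) (trans (sideN r₁) (trans (sym (sideN r₂)) X₀-y)))

        P-y : lookup P y ≡ false
        P-y = unreach⇒unreachable (λ r → not-with-y X₀-a r here)
        Q-y : lookup Q y ≡ false
        Q-y = unreach⇒unreachable (λ r → not-with-y X₀-b r here)
        Y-a : lookup Y a ≡ false
        Y-a = unreach⇒unreachable (λ r → not-with-y X₀-a here r)
        Y-b : lookup Y b ≡ false
        Y-b = unreach⇒unreachable (λ r → not-with-y X₀-b here r)
        Y-y : lookup Y y ≡ true
        Y-y = reach⇒reachable here

        U = P ∪ Q ∪ Y

        ∈U : ∀ {v} → a ~[ N ] v ⊎ b ~[ N ] v ⊎ y ~[ N ] v → v ∈ U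
        ∈U (inj₁ r) = x∈p∪q⁺ (inj₁ (lookup≡true⇒∈ (reach⇒reachable r)))
        ∈U (inj₂ (inj₁ r)) = x∈p∪q⁺ (inj₂ (x∈p∪q⁺ (inj₁ (lookup≡true⇒∈ (reach⇒reachable r)))))
        ∈U (inj₂ (inj₂ r)) = x∈p∪q⁺ (inj₂ (x∈p∪q⁺ (inj₂ (lookup≡true⇒∈ (reach⇒reachable r)))))

        U⇒a~ : ∀ {v} → v ∈ U → a ~[ allEdges G ] v
        U⇒a~ v∈U with x∈p∪q⁻ P _ v∈U
        ... | inj₁ v∈P = reach-mono ⊆allEdges (reachable⇒reach (∈⇒lookup≡true v∈P))
        ... | inj₂ v∈QY with x∈p∪q⁻ Q _ v∈QY
        ...   | inj₁ v∈Q = reach-trans a~ᴳb (reach-mono ⊆allEdges (reachable⇒reach (∈⇒lookup≡true v∈Q)))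
        ...   | inj₂ v∈Y = reach-trans a~y (reach-mono ⊆allEdges (reachable⇒reach (∈⇒lookup≡true v∈Y)))

        y′∈Y : lookup Y y′ ≡ true
        y′∈Y with classify y′ (reach-trans a~ᴳb (reach-trans (reach-mono ⊆allEdges b~z′) (reach-edge (∈allEdges g) g-z′y′)))
        ... | inj₁ r = ⊥-elim (true≢false (trans (sym X₀-a) (trans (sideN r) X₀-y′)))
        ... | inj₂ (inj₁ r) = ⊥-elim (true≢false (trans (sym X₀-b) (trans (sideN r) X₀-y′)))
        ... | inj₂ (inj₂ r) = reach⇒reachable r

        tripartition : IsTripartition G P Q Y
        tripartition =
          ((a , ∈U (inj₁ here)) , λ u v u∈U → (λ v∈U → reach-trans (reach-sym (U⇒a~ u∈U)) (U⇒a~ v∈U)) ,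
                                               (λ p → ∈U (classify v (reach-trans (U⇒a~ u∈U) p)))) ,
          (λ v v∈P v∈Q → Cut-a.a≁b (reach-trans (reachable⇒reach (∈⇒lookup≡true v∈P))
                                                 (reach-sym (reachable⇒reach (∈⇒lookup≡true v∈Q))))) ,
          (λ v v∈P v∈Y → not-with-y X₀-a (reachable⇒reach (∈⇒lookup≡true v∈P)) (reachable⇒reach (∈⇒lookup≡true v∈Y))) ,
          (λ v v∈Q v∈Y → not-with-y X₀-b (reachable⇒reach (∈⇒lookup≡true v∈Q)) (reachable⇒reach (∈⇒lookup≡true v∈Y))) ,
          reachable-connected N a , reachable-connected N b , reachable-connected N y ,
          (t , a , b , lookup≡true⇒∈ Cut-a.P-a , lookup≡true⇒∈ Cut-b.P-a , joins-ends t) ,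
          (f , x′ , y , lookup≡true⇒∈ x′∈P , lookup≡true⇒∈ Y-y , f-x′y) ,
          (g , z′ , y′ , lookup≡true⇒∈ z′∈Q , lookup≡true⇒∈ y′∈Y , g-z′y′)

        Tr = δ G P ∪ δ G Q ∪ δ G Y

        N-off-Tr : ∀ e → src e ~[ N ] tgt e → e ∉ Tr
        N-off-Tr e r e∈Tr with x∈p∪q⁻ (δ G P) _ e∈Tr
        ... | inj₁ e∈δP = crosses P e∈δP (Cut-a.sideP r)
        ... | inj₂ e∈δQY with x∈p∪q⁻ (δ G Q) _ e∈δQY
        ...   | inj₁ e∈δQ = crosses Q e∈δQ (Cut-b.sideP r)
        ...   | inj₂ e∈δY = crosses Y e∈δY (reachable-side y r)

        N-avoids-Tr : ∀ e → e ∈ N → e ∉ Tr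
        N-avoids-Tr e e∈N = N-off-Tr e (reach-ends e e∈N)

        Tr⊆ : (outside ∷ Tr) ⊆ ⁅ suc t ⁆ ∪ dualBasis
        Tr⊆ = ⊆-edge∪∁ t Tr T (λ ()) Tr∩T
          where
          Tr∩T : ∀ e → e ∈ Tr → e ∈ T → e ≡ t
          Tr∩T e e∈Tr e∈T with e ≟ t
          ... | yes e≡t = e≡t
          ... | no e≢t = ⊥-elim (N-avoids-Tr e (Cut-a.∈N e e∈T e≢t) e∈Tr)

        Tr-edge-from-a : ∀ e → e ∈ Tr → a ~[ allEdges G ] src e
        Tr-edge-from-a e e∈Tr with TripartitionFacts.Tr-edge-touches-U P Q Y tripartition e e∈Tr
        ... | inj₁ s∈U = U⇒a~ s∈U
        ... | inj₂ t∈U = reach-trans (U⇒a~ t∈U) (reach-sym (reach-ends e (∈allEdges e)))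

        anchored : ∀ e → e ∈ Tr → ∃[ i ] ((triple a a b i ~[ N ] src e × triple b y y i ~[ N ] tgt e) ⊎
                                          (triple b y y i ~[ N ] src e × triple a a b i ~[ N ] tgt e))
        anchored e e∈Tr with classify (src e) (Tr-edge-from-a e e∈Tr)
                           | classify (tgt e) (reach-trans (Tr-edge-from-a e e∈Tr) (reach-ends e (∈allEdges e)))
        ... | inj₁ r₁ | inj₂ (inj₁ r₂) = zero , inj₁ (r₁ , r₂)
        ... | inj₂ (inj₁ r₁) | inj₁ r₂ = zero , inj₂ (r₁ , r₂)
        ... | inj₁ r₁ | inj₂ (inj₂ r₂) = suc zero , inj₁ (r₁ , r₂)
        ... | inj₂ (inj₂ r₁) | inj₁ r₂ = suc zero , inj₂ (r₁ , r₂)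
        ... | inj₂ (inj₁ r₁) | inj₂ (inj₂ r₂) = suc (suc zero) , inj₁ (r₁ , r₂)
        ... | inj₂ (inj₂ r₁) | inj₂ (inj₁ r₂) = suc (suc zero) , inj₂ (r₁ , r₂)
        ... | inj₁ r₁ | inj₁ r₂ = ⊥-elim (N-off-Tr e (reach-trans (reach-sym r₁) r₂) e∈Tr)
        ... | inj₂ (inj₁ r₁) | inj₂ (inj₁ r₂) = ⊥-elim (N-off-Tr e (reach-trans (reach-sym r₁) r₂) e∈Tr)
        ... | inj₂ (inj₂ r₁) | inj₂ (inj₂ r₂) = ⊥-elim (N-off-Tr e (reach-trans (reach-sym r₁) r₂) e∈Tr)

        open CutSignatures Tr N (triple a a b) (triple b y y) N-avoids-Tr anchored

        δP⊆Tr : δ G P ⊆ Tr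
        δP⊆Tr h = x∈p∪q⁺ (inj₁ h)
        δQ⊆Tr : δ G Q ⊆ Tr
        δQ⊆Tr h = x∈p∪q⁺ (inj₂ (x∈p∪q⁺ (inj₁ h)))
        δY⊆Tr : δ G Y ⊆ Tr
        δY⊆Tr h = x∈p∪q⁺ (inj₂ (x∈p∪q⁺ (inj₂ h)))

        -- Y is the complement of X₀ within U, so δY = B₀.
        Y-outside-X₀ : ∀ v → a ~[ allEdges G ] v → lookup X₀ v ≡ false → lookup Y v ≡ true
        Y-outside-X₀ v p v∉X₀ with classify v p
        ... | inj₁ r = ⊥-elim (true≢false (trans (sym X₀-a) (trans (sideN r) v∉X₀)))
        ... | inj₂ (inj₁ r) = ⊥-elim (true≢false (trans (sym X₀-b) (trans (sideN r) v∉X₀)))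
        ... | inj₂ (inj₂ r) = reach⇒reachable r

        Y-misses-X₀ : ∀ v → lookup X₀ v ≡ true → lookup Y v ≡ false
        Y-misses-X₀ v v∈X₀ = unreach⇒unreachable (λ r → true≢false (trans (sym v∈X₀) (trans (sym (sideN r)) X₀-y)))

        δX₀⊆Tr : δ G X₀ ⊆ Tr
        δX₀⊆Tr {e} e∈δX₀ = δY⊆Tr (crossing⇒∈δ Y e (by-sides (lookup X₀ (src e)) (lookup X₀ (tgt e)) refl refl))
          where
          a~s : a ~[ allEdges G ] src e
          a~s = reach-trans a~e* (B₀-connected e (∈B₀ e∈δX₀))
          a~t : a ~[ allEdges G ] tgt e
          a~t = reach-trans a~s (reach-ends e (∈allEdges e))
          by-sides : ∀ s t → lookup X₀ (src e) ≡ s → lookup X₀ (tgt e) ≡ t → lookup Y (src e) ≢ lookup Y (tgt e)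
          by-sides true true q₁ q₂ _ = crosses X₀ e∈δX₀ (trans q₁ (sym q₂))
          by-sides false false q₁ q₂ _ = crosses X₀ e∈δX₀ (trans q₁ (sym q₂))
          by-sides true false q₁ q₂ eq = true≢false (trans (sym (Y-outside-X₀ _ a~t q₂)) (trans (sym eq) (Y-misses-X₀ _ q₁)))
          by-sides false true q₁ q₂ eq = true≢false (trans (sym (Y-outside-X₀ _ a~s q₁)) (trans eq (Y-misses-X₀ _ q₂)))

        signature-P : ∀ i → signature P i ≡ triple true true false i
        signature-P zero = cong₂ _xor_ Cut-a.P-a Cut-a.P-b
        signature-P (suc zero) = cong₂ _xor_ Cut-a.P-a P-y
        signature-P (suc (suc zero)) = cong₂ _xor_ Cut-a.P-b P-y
        signature-Q : ∀ i → signature Q i ≡ triple true false true i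
        signature-Q zero = cong₂ _xor_ Cut-b.P-b Cut-b.P-a
        signature-Q (suc zero) = cong₂ _xor_ Cut-b.P-b Q-y
        signature-Q (suc (suc zero)) = cong₂ _xor_ Cut-b.P-a Q-y
        signature-Y : ∀ i → signature Y i ≡ triple false true true i
        signature-Y zero = cong₂ _xor_ Y-a Y-b
        signature-Y (suc zero) = cong₂ _xor_ Y-a Y-y
        signature-Y (suc (suc zero)) = cong₂ _xor_ Y-b Y-y
        signature-X₀ : ∀ i → signature X₀ i ≡ triple false true true i
        signature-X₀ zero = cong₂ _xor_ X₀-a X₀-b
        signature-X₀ (suc zero) = cong₂ _xor_ X₀-a X₀-y
        signature-X₀ (suc (suc zero)) = cong₂ _xor_ X₀-b X₀-y

        δY≡B₀ : δ G Y ≡ B₀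
        δY≡B₀ = trans (δ-≡-by-signature Y X₀ δY⊆Tr δX₀⊆Tr (λ i → trans (signature-Y i) (sym (signature-X₀ i)))) (sym B₀≡δX₀)

        signature-≡⇒δ-≡ : ∀ Z W {x y z} → δ G Z ⊆ Tr → δ G W ⊆ Tr → (∀ i → signature W i ≡ triple x y z i) →
                          signature Z zero ≡ x → signature Z (suc zero) ≡ y → signature Z (suc (suc zero)) ≡ z →
                          δ G Z ≡ δ G W
        signature-≡⇒δ-≡ Z W δZ⊆Tr δW⊆Tr sig-W z₀ z₁ z₂ = δ-≡-by-signature Z W δZ⊆Tr δW⊆Tr λ
          { zero → trans z₀ (sym (sig-W zero))
          ; (suc zero) → trans z₁ (sym (sig-W (suc zero)))
          ; (suc (suc zero)) → trans z₂ (sym (sig-W (suc (suc zero)))) }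

        -- A cut inside Tr has an even signature, so it is δP, δQ, δY = B₀, or empty.
        no-L-bond : L (δ G P) ≡ false → L (δ G Q) ≡ false → ContainsNoBondOf G L Tr
        no-L-bond δP∉L δQ∉L _ ((Z , refl) , nonempty , _) Z∈L δZ⊆Tr
          with signature Z zero in s₀ | signature Z (suc zero) in s₁ | signature Z (suc (suc zero)) in s₂
             | xor-triangle (lookup Z a) (lookup Z b) (lookup Z y)
        ... | true | true | false | _ =
          true≢false (trans (sym Z∈L) (trans (cong L (signature-≡⇒δ-≡ Z P δZ⊆Tr δP⊆Tr signature-P s₀ s₁ s₂)) δP∉L))
        ... | true | false | true | _ =
          true≢false (trans (sym Z∈L) (trans (cong L (signature-≡⇒δ-≡ Z Q δZ⊆Tr δQ⊆Tr signature-Q s₀ s₁ s₂)) δQ∉L))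
        ... | false | true | true | _ =
          true≢false (trans (sym Z∈L) (trans (cong L (trans (signature-≡⇒δ-≡ Z Y δZ⊆Tr δY⊆Tr signature-Y s₀ s₁ s₂) δY≡B₀)) B₀∉L))
        ... | false | false | false | _ =
          signature-false⇒empty Z δZ⊆Tr (λ { zero → s₀ ; (suc zero) → s₁ ; (suc (suc zero)) → s₂ }) nonempty
        ... | true | true | true | ()
        ... | true | false | false | ()
        ... | false | true | false | ()
        ... | false | false | true | ()

        cocircuit : FundamentalCocircuit t
        cocircuit with L (δ G P) in δP∈?L | L (δ G Q) in δQ∈?L
        ... | true | _ =
          (outside ∷ δ G P) , inj₁ (δ G P , L-bonds _ δP∈?L , δP∈?L , refl) , ⊆-edge∪∁ t (δ G P) T (λ ()) Cut-a.δP∩T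
        ... | false | true =
          (outside ∷ δ G Q) , inj₁ (δ G Q , L-bonds _ δQ∈?L , δQ∈?L , refl) , ⊆-edge∪∁ t (δ G Q) T (λ ()) Cut-b.δP∩T
        ... | false | false =
          (outside ∷ Tr) , inj₂ (inj₂ (Tr , inj₁ (P , Q , Y , tripartition , refl) , no-L-bond δP∈?L δQ∈?L , refl)) , Tr⊆

      cocircuit : FundamentalCocircuit t
      cocircuit with meets-B₀? P | meets-B₀? Q
      ... | no P-misses | no Q-misses = NeitherMeets.cocircuit P-misses Q-misses
      ... | yes (f , f∈B₀ , f-end) | no Q-misses with oriented-end P f f-end
      ...   | u , v , j , u∈P = OneMeets.cocircuit a b (inj₂ (refl , refl)) X₀-a X₀-b f u v j f∈B₀ u∈P Q-misses
      cocircuit | no P-misses | yes (g , g∈B₀ , g-end) with oriented-end Q g g-end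
      ...   | u , v , j , u∈Q = OneMeets.cocircuit b a (inj₁ (refl , refl)) X₀-b X₀-a g u v j g∈B₀ u∈Q P-misses
      cocircuit | yes (f , f∈B₀ , f-end) | yes (g , g∈B₀ , g-end) with oriented-end P f f-end | oriented-end Q g g-end
      ...   | u , v , j , u∈P | u′ , v′ , j′ , u′∈Q = BothMeet.cocircuit f u v j f∈B₀ u∈P g u′ v′ j′ g∈B₀ u′∈Q

    independent : J₀Independent G L (inside ∷ F)
    independent = dualBasis , dualBasis-disjoint , dualBasis-free , maximal
      where
      maximal : ∀ x → x ∉ dualBasis → ∃[ D ] (J₀Cocircuit G L D × D ⊆ ⁅ x ⁆ ∪ dualBasis)
      maximal zero _ = (inside ∷ B₀) , inj₂ (inj₁ (B₀ , B₀-bond , B₀∉L , refl)) , e₀∪B₀⊆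
        where
        e₀∪B₀⊆ : (inside ∷ B₀) ⊆ ⁅ zero ⁆ ∪ dualBasis
        e₀∪B₀⊆ here = x∈p∪q⁺ {p = ⁅ zero ⁆} {q = dualBasis} (inj₁ here)
        e₀∪B₀⊆ (there e∈B₀) = x∈p∪q⁺ {p = ⁅ zero ⁆} {q = dualBasis} (inj₂ (there (x∉p⇒x∈∁p (λ e∈T → T∌B₀ e∈T e∈B₀))))
      maximal (suc t) t∉ = Fundamental.cocircuit t (x∉∁p⇒x∈p (λ h → t∉ (there h)))

-- Of the hypotheses on 𝓛 only "𝓛 consists of bonds" is used: linearity and non-triviality are
-- what make J₀ a matroid, whereas here independence is witnessed by an explicit dual basis.
theorem3p5 : (G : Graph) (L : Subset (Graph.m G) → Bool) →
    IsLinearClass G L → NonTrivial G L →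
    (I : Subset (suc (Graph.m G))) →
    J₀Independent G L I ⇔
      ((∃[ F ] (IsForest G F × I ≡ outside ∷ F)) ⊎
       (∃[ F ] (IsForest G F × UnCobalanced G L F × I ≡ inside ∷ F)))
theorem3p5 G L (L-bonds , _) _ I = mk⇔ (independent⇒forest-form G L I) forest-form⇒independent
  where
  forest-form⇒independent : (∃[ F ] (IsForest G F × I ≡ outside ∷ F)) ⊎
                            (∃[ F ] (IsForest G F × UnCobalanced G L F × I ≡ inside ∷ F)) → J₀Independent G L I
  forest-form⇒independent (inj₁ (F , forest , refl)) = forest⇒independent G L F forest
  forest-form⇒independent (inj₂ (F , forest , (B₀ , B₀-bond , B₀-ext , B₀∉L) , refl)) =
    UnCobalancedForest.independent G L L-bonds F B₀ forest B₀-bond B₀-ext B₀∉L
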